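{- Fix a positive integer $N$, a positive integer $q'$ and an integer $a'$ with $\gcd(a',q')=1$. For cubefree $q$ define $$h_q(r)=\sum_{a \bmod q}\varphi(q')\rho_q^*(a)\,\mathbf{e}_q(-ra),\qquad b(q)=\sum_{\substack{1\le r\le q\\ \gcd(r,q)=1}}\mathbf{e}_q(rN)\,h_q(r).$$ Then $b$ is a multiplicative function of $q$ (on cubefree $q$), and for every prime $p$, $$b(p)=\begin{cases}\dfrac{ -p\,c_p(N)}{\varphi(p)} & \text{if } p\nmid q',\\[6pt] p\,c_p(N-a') & \text{if } p\mid q',\end{cases}\qquad\qquad b(p^2)=\mathbb{1}_{p^2\mid q'}\cdot p^2\,c_{p^2}(N-a').$$
   Context: $\mu$ is the Möbius function, $\varphi$ Euler's totient function; a positive integer is cubefree if not divisible by $p^3$ for any prime $p$. $\mathbf{e}_q(t)=\exp(2\pi i t/q)$. $c_r(n)=\sum_{1\le b\le r,\gcd(b,r)=1}\mathbf{e}_r(bn)$ is the Ramanujan sum. For cubefree $q$ and integers $a$: $\rho_q(a)=0$ if $\gcd(a,q)>1$ or $\gcd(q,q')\nmid(a-a')$, and $\rho_q(a)=q/\varphi(\mathrm{lcm}(q,q'))$ otherwise; $\rho_q^*(a)=\sum_{d\mid q}\mu(q/d)\rho_d(a)$ (which depends only on $a \bmod q$). -}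

module Defs where

open import Level using (Level; _⊔_) renaming (suc to lsuc)
open import Algebra.Bundles using (CommutativeRing)
open import Data.Nat as ℕ using (ℕ; zero; suc; _<_; _≤_; NonZero)
open import Data.Nat.GCD using (gcd)
open import Data.Nat.LCM using (lcm)
open import Data.Nat.Divisibility using (_∣_; _∣?_)
open import Data.Nat.Primality using (Prime; prime?)
open import Data.Integer as ℤ using (ℤ; +_; ∣_∣)
open import Data.Integer.Base using (_%ℕ_)
open import Data.Nat.Base using (_≡ᵇ_)
import Data.Nat.DivMod as DM
open import Data.Bool using (Bool; true; false; if_then_else_)
open import Data.Product using (Σ; ∃; _×_)
open import Relation.Nullary using (¬_; Dec; yes; no)
open import Relation.Nullary.Decidable using (⌊_⌋)

sumℕ : ℕ → (ℕ → ℕ) → ℕ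
sumℕ zero    f = 0
sumℕ (suc n) f = sumℕ n f ℕ.+ f (suc n)

φ : ℕ → ℕ
φ n = sumℕ n (λ k → if gcd k n ≡ᵇ 1 then 1 else 0)

hasSquareFactor : ℕ → Bool
hasSquareFactor n =
  ℕ._<ᵇ_ 0 (sumℕ n (λ d → if ℕ._≤ᵇ_ 2 d then (if ⌊ (d ℕ.* d) ∣? n ⌋ then 1 else 0) else 0))

-- exact quotient q / d for d ≥ 1 (junk value 0 at d = 0)
quot : ℕ → ℕ → ℕ
quot q zero    = 0
quot q (suc d) = q DM./ suc d

ω : ℕ → ℕ
ω n = sumℕ n (λ p → if ⌊ prime? p ⌋ then (if ⌊ p ∣? n ⌋ then 1 else 0) else 0)

μ : ℕ → ℤ
μ zero = ℤ.0ℤ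
μ n@(suc _) = if hasSquareFactor n then ℤ.0ℤ else (ℤ.-1ℤ ℤ.^ ω n)

Cubefree : ℕ → Set
Cubefree q = (0 < q) × (∀ p → Prime p → ¬ ((p ℕ.^ 3) ∣ q))

-- A field of characteristic 0 equipped with a compatible system of
-- primitive roots of unity ζ q (playing the role of e_q(1) = exp(2πi/q)).

module _ {c ℓ : Level} (R : CommutativeRing c ℓ) where
  open CommutativeRing R

  ιℕ : ℕ → Carrier
  ιℕ zero    = 0#
  ιℕ (suc n) = 1# + ιℕ n

  ιℤ : ℤ → Carrier
  ιℤ (+ n)       = ιℕ n
  ιℤ ℤ.-[1+ n ]  = - ιℕ (suc n)

  pow : Carrier → ℕ → Carrier
  pow x zero    = 1#
  pow x (suc n) = x * pow x n

record CycloField (c ℓ : Level) : Set (lsuc (c ⊔ ℓ)) where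
  field
    K : CommutativeRing c ℓ
  open CommutativeRing K
  field
    nontrivial : ¬ (1# ≈ 0#)
    inverses   : ∀ x → ¬ (x ≈ 0#) → ∃ λ y → x * y ≈ 1#
    -- reciprocals of positive integers (forces characteristic 0)
    recip      : ℕ → Carrier
    recip-spec : ∀ n → ιℕ K (suc n) * recip (suc n) ≈ 1#
    ζ          : ℕ → Carrier
    ζ-root     : ∀ q → pow K (ζ (suc q)) (suc q) ≈ 1#
    ζ-prim     : ∀ q k → 0 < k → k < suc q → ¬ (pow K (ζ (suc q)) k ≈ 1#)
    ζ-compat   : ∀ m q → pow K (ζ (suc m ℕ.* suc q)) (suc m) ≈ ζ (suc q)

module CF {c ℓ : Level} (F : CycloField c ℓ) where
  open CycloField F public
  open CommutativeRing K public

  ι : ℕ → Carrier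
  ι = ιℕ K

  ιz : ℤ → Carrier
  ιz = ιℤ K

  -- division by a natural number (junk value at 0)
  _/ι_ : Carrier → ℕ → Carrier
  x /ι n = x * recip n

  Σ1 : ℕ → (ℕ → Carrier) → Carrier
  Σ1 (zero ) f = 0#
  Σ1 (suc n) f = Σ1 (n) f + f (suc n)

  Σ0 : ℕ → (ℤ → Carrier) → Carrier
  Σ0 (zero) f = 0#
  Σ0 (suc n) f = Σ0 (n) f + f (+ n)

  -- e_q(t) = exp(2πi t / q), realised as ζ_q^(t mod q)  (q ≥ 1)
  e : ℕ → ℤ → Carrier
  e zero    t = 1#
  e (suc k) t = pow K (ζ (suc k)) (t %ℕ suc k)

  Σunits : ℕ → (ℕ → Carrier) → Carrier
  Σunits q f = Σ1 (q) (λ r → if gcd r q ≡ᵇ 1 then f r else 0#)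

  Σdiv : ℕ → (ℕ → Carrier) → Carrier
  Σdiv q f = Σ1 (q) (λ d → if ⌊ d ∣? q ⌋ then f d else 0#)

  cR : ℕ → ℤ → Carrier
  cR r n = Σunits r (λ b → e r (+ b ℤ.* n))

  module Fixed (N q' : ℕ) (a' : ℤ) where
    ρ : ℕ → ℤ → Carrier
    ρ q a =
      if (gcd ∣ a ∣ q ≡ᵇ 1) then
        (if ⌊ gcd q q' ∣? ∣ a ℤ.- a' ∣ ⌋
          then ι q /ι φ (lcm q q')
          else 0#)
      else 0#

    ρ* : ℕ → ℤ → Carrier
    ρ* q a = Σdiv q (λ d → ιz (μ (quot q d)) * ρ d a)

    h : ℕ → ℕ → Carrier
    h q r = Σ0 (q) (λ a → ι (φ q') * ρ* q a * e q (ℤ.- (+ r ℤ.* a)))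

    b : ℕ → Carrier
    b q = Σunits q (λ r → e q (+ r ℤ.* + N) * h q r)

module Submission where

-- Lemma 5.12.  For a unit r mod q the Möbius sum ρ*_q collapses in h_q(r):
-- each ρ_d (d a proper divisor of q) is d-periodic, hence orthogonal to
-- a ↦ e_q(−r·a) as q/d ∤ r.  With ρ_q(a) = q/φ(lcm(q, q')) · w_q(a), where
-- w_q(a) = [gcd(a, q) = 1]·[a ≡ a' mod gcd(q, q')], this gives
--     b(q) = κ(q) · D(q),  κ(q) = φ(q')·q/φ(lcm(q, q')),
--     D(q) = Σ_{r unit} Σ_{a mod q} w_q(a) e_q(r(N − a)).
-- κ is multiplicative by a totient identity, D by the Chinese remainder
-- theorem.  For q ∣ q', w_q picks out a ≡ a' and b(q) = q·c_q(N − a'); for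
-- p ∤ q', κ(p) = p/φ(p) and D(p) = −c_p(N); for p² ∤ q', w_{p²} is
-- p-periodic and D(p²) = 0.
-- Modules: Arithmetic and Permutations (elementary facts), FiniteSums
-- (sums over [0, n), CRT reindexing), Totient (φ identities), Cyclotomic
-- (characters and orthogonality), Lemma5p12 (the sums for fixed N, q', a');
-- the theorem comes last.

open import Defs
open import Level using (Level)
import Algebra
open import Data.Nat using (ℕ; _<_; _^_) renaming (_*_ to _*ℕ_)
open import Data.Nat.GCD using (gcd)
open import Data.Nat.Coprimality using (Coprime)
open import Data.Nat.Divisibility using (_∣_)
open import Data.Nat.Primality using (Prime)
open import Data.Integer using (ℤ; +_; ∣_∣) renaming (_-_ to _-ℤ_)
open import Data.Product using (_×_)
open import Relation.Binary.PropositionalEquality using (_≡_)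
open import Relation.Nullary using (¬_)

open import Data.Product using (_,_)
import Data.Nat.Properties as ℕP
import Relation.Binary.PropositionalEquality as P

module Arithmetic where

  open import Data.Nat.Base
  open import Data.Nat.Properties
  open import Data.Nat.Divisibility
  open import Data.Nat.DivMod
  open import Data.Nat.GCD
  open import Data.Nat.LCM using (lcm; gcd*lcm; lcm-least; n∣lcm[m,n])
  open import Data.Nat.Coprimality as Cop using (Coprime)
  open import Data.Nat.Primality using (Prime; prime⇒nonTrivial; prime⇒irreducible)
  open import Data.Integer as ℤ using (ℤ; +_; ∣_∣)
  import Data.Integer.Properties as ℤP
  import Data.Integer.DivMod as ℤDM
  import Data.Integer.Divisibility.Signed as ZD
  open import Data.Integer.Tactic.RingSolver using (solve-∀)
  open import Data.Bool using (Bool; true; false; T)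
  open import Relation.Binary.PropositionalEquality
  open import Relation.Nullary.Decidable using (⌊_⌋)
  open import Data.Product
  open import Data.Sum
  open import Data.Empty
  open import Relation.Nullary

  infix 3 _⇔_
  _⇔_ : Set → Set → Set
  A ⇔ B = (A → B) × (B → A)

  infix 4 _≋_[_]
  record _≋_[_] (x y : ℤ) (m : ℕ) : Set where
    constructor cg
    field un : (+ m) ZD.∣ (x ℤ.- y)
  open _≋_[_] public

  ≋-refl : ∀ {x m} → x ≋ x [ m ]
  ≋-refl {x} {m} = cg (subst (+ m ZD.∣_) (sym (x-x≡0 x)) (ZD.∣ᵤ⇒∣ {+ m} {ℤ.0ℤ} (m ∣0)))
    where
    x-x≡0 : ∀ x → x ℤ.- x ≡ ℤ.0ℤ
    x-x≡0 = solve-∀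

  ≋-reflexive : ∀ {x y m} → x ≡ y → x ≋ y [ m ]
  ≋-reflexive refl = ≋-refl

  ≋-sym : ∀ {x y m} → x ≋ y [ m ] → y ≋ x [ m ]
  ≋-sym {x} {y} (cg p) = cg (subst (_ ZD.∣_) (negate-diff x y) (ZD.∣m⇒∣-m p))
    where
    negate-diff : ∀ x y → ℤ.- (x ℤ.- y) ≡ y ℤ.- x
    negate-diff = solve-∀

  ≋-trans : ∀ {x y z m} → x ≋ y [ m ] → y ≋ z [ m ] → x ≋ z [ m ]
  ≋-trans {x} {y} {z} (cg p) (cg q) = cg (subst (_ ZD.∣_) (chain x y z) (ZD.∣m∣n⇒∣m+n p q))
    where
    chain : ∀ x y z → (x ℤ.- y) ℤ.+ (y ℤ.- z) ≡ x ℤ.- z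
    chain = solve-∀

  ≋-+ : ∀ {x y u v m} → x ≋ y [ m ] → u ≋ v [ m ] → x ℤ.+ u ≋ y ℤ.+ v [ m ]
  ≋-+ {x} {y} {u} {v} (cg p) (cg q) = cg (subst (_ ZD.∣_) (diff-+ x y u v) (ZD.∣m∣n⇒∣m+n p q))
    where
    diff-+ : ∀ x y u v → (x ℤ.- y) ℤ.+ (u ℤ.- v) ≡ (x ℤ.+ u) ℤ.- (y ℤ.+ v)
    diff-+ = solve-∀

  ≋-* : ∀ {x y u v m} → x ≋ y [ m ] → u ≋ v [ m ] → x ℤ.* u ≋ y ℤ.* v [ m ]
  ≋-* {x} {y} {u} {v} (cg p) (cg q) = cg (subst (_ ZD.∣_) (diff-* x y u v)
    (ZD.∣m∣n⇒∣m+n (ZD.∣m⇒∣m*n u p) (ZD.∣n⇒∣m*n y q)))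
    where
    diff-* : ∀ x y u v → (x ℤ.- y) ℤ.* u ℤ.+ y ℤ.* (u ℤ.- v) ≡ x ℤ.* u ℤ.- y ℤ.* v
    diff-* = solve-∀

  ≋-neg : ∀ {x y m} → x ≋ y [ m ] → ℤ.- x ≋ ℤ.- y [ m ]
  ≋-neg {x} {y} (cg p) = cg (subst (_ ZD.∣_) (diff-neg x y) (ZD.∣m⇒∣-m p))
    where
    diff-neg : ∀ x y → ℤ.- (x ℤ.- y) ≡ ℤ.- x ℤ.- ℤ.- y
    diff-neg = solve-∀

  ≋-div : ∀ {x y m k} → k ∣ m → x ≋ y [ m ] → x ≋ y [ k ]
  ≋-div k∣m (cg p) = cg (ZD.∣-trans (ZD.∣ᵤ⇒∣ k∣m) p)

  ≋-scale : ∀ {x y s} d → x ≋ y [ s ] → + d ℤ.* x ≋ + d ℤ.* y [ d * s ]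
  ≋-scale {x} {y} {s} d (cg p) = cg (ZD.∣ᵤ⇒∣ (subst (d * s ∣_) abs-eq (*-monoʳ-∣ d (ZD.∣⇒∣ᵤ p))))
    where
    distrib : ∀ a b c → c ℤ.* (a ℤ.- b) ≡ c ℤ.* a ℤ.- c ℤ.* b
    distrib = solve-∀
    abs-eq : d * ∣ x ℤ.- y ∣ ≡ ∣ + d ℤ.* x ℤ.- + d ℤ.* y ∣
    abs-eq = trans (sym (ℤP.abs-* (+ d) (x ℤ.- y))) (cong ∣_∣ (distrib x y (+ d)))

  ≋-mod1 : ∀ {x y} → x ≋ y [ 1 ]
  ≋-mod1 {x} {y} = cg (ZD.∣ᵤ⇒∣ (1∣ ∣ x ℤ.- y ∣))

  ≋-mul0 : ∀ {m} z → z ℤ.* + m ≋ ℤ.0ℤ [ m ]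
  ≋-mul0 {m} z = cg (subst (_ ZD.∣_) (sym (ℤP.+-identityʳ (z ℤ.* + m))) (ZD.∣n⇒∣m*n z ZD.∣-refl))

  ≋-mul0ˡ : ∀ q x → + q ℤ.* x ≋ + 0 ℤ.* x [ q ]
  ≋-mul0ˡ q x = ≋-trans (≋-reflexive (ℤP.*-comm (+ q) x)) (≋-trans (≋-mul0 x) (≋-reflexive (sym (ℤP.*-zeroˡ x))))

  ∣⇒≋0 : ∀ {d x} → d ∣ x → + x ≋ ℤ.0ℤ [ d ]
  ∣⇒≋0 {d} {x} p = cg (subst (+ d ZD.∣_) (sym (ℤP.+-identityʳ (+ x))) (ZD.∣ᵤ⇒∣ p))

  ≋-addmul : ∀ a b m → + (a + b * m) ≋ + a [ m ]
  ≋-addmul a b m = subst (λ u → + (a + b * m) ≋ u [ m ]) (ℤP.+-identityʳ (+ a))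
    (≋-+ {+ a} {+ a} {+ (b * m)} {ℤ.0ℤ} ≋-refl (∣⇒≋0 (n∣m*n b)))

  ≋-addmulˡ : ∀ a b m → + (b * m + a) ≋ + a [ m ]
  ≋-addmulˡ a b m = subst (λ t → + t ≋ + a [ m ]) (+-comm a (b * m)) (≋-addmul a b m)

  %ℕ-≋ : ∀ t m .{{_ : NonZero m}} → + (t ℤ.%ℕ m) ≋ t [ m ]
  %ℕ-≋ t m = ≋-sym (subst (λ u → u ≋ r [ m ]) (sym (ℤDM.a≡a%ℕn+[a/ℕn]*n t m)) drop-multiple)
    where
    r = + (t ℤ.%ℕ m)
    drop-multiple : r ℤ.+ (t ℤ./ℕ m) ℤ.* + m ≋ r [ m ]
    drop-multiple = subst (λ u → r ℤ.+ (t ℤ./ℕ m) ℤ.* + m ≋ u [ m ]) (ℤP.+-identityʳ r)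
      (≋-+ {r} {r} ≋-refl (≋-mul0 (t ℤ./ℕ m)))

  %-≋ : ∀ x m .{{_ : NonZero m}} → + (x % m) ≋ + x [ m ]
  %-≋ x m = %ℕ-≋ (+ x) m

  -- Two residues in [0, m) that are congruent modulo m are equal
  -- (first assuming x ≤ y, so that m divides y ∸ x < m).
  ≋-small-ordered : ∀ {x y m} → x ≤ y → y < m → + x ≋ + y [ m ] → x ≡ y
  ≋-small-ordered {x} {y} {m} x≤y y<m (cg p) = ≤-antisym x≤y (m∸n≡0⇒m≤n y∸x≡0)
    where
    m∣y∸x : m ∣ y ∸ x
    m∣y∸x = subst (m ∣_) (trans (cong ∣_∣ (ℤP.[+m]-[+n]≡m⊖n x y)) (ℤP.∣⊖∣-≤ x≤y)) (ZD.∣⇒∣ᵤ p)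
    y∸x≡0 : y ∸ x ≡ 0
    y∸x≡0 with y ∸ x | m∣y∸x | m∸n≤m y x
    ... | zero  | _ | _ = refl
    ... | suc k | d | le = ⊥-elim (>⇒∤ (≤-<-trans le y<m) d)

  ≋-small : ∀ {x y m} → x < m → y < m → + x ≋ + y [ m ] → x ≡ y
  ≋-small {x} {y} x<m y<m e with ≤-total x y
  ... | inj₁ x≤y = ≋-small-ordered x≤y y<m e
  ... | inj₂ y≤x = sym (≋-small-ordered y≤x x<m (≋-sym e))

  ≋⇒%ℕ≡ : ∀ {x y m} .{{_ : NonZero m}} → x ≋ y [ m ] → x ℤ.%ℕ m ≡ y ℤ.%ℕ m
  ≋⇒%ℕ≡ {x} {y} {m} e = ≋-small (ℤDM.n%ℕd<d x m) (ℤDM.n%ℕd<d y m)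
    (≋-trans (%ℕ-≋ x m) (≋-trans e (≋-sym (%ℕ-≋ y m))))

  %ℕ≡0⇒∣ : ∀ x s .{{_ : NonZero s}} → x ℤ.%ℕ s ≡ 0 → s ∣ ∣ x ∣
  %ℕ≡0⇒∣ x s e = subst (s ∣_) (trans (cong ∣_∣ (ℤP.+-identityˡ (ℤ.- x))) (ℤP.∣-i∣≡∣i∣ x))
    (ZD.∣⇒∣ᵤ (un (subst (λ t → + t ≋ x [ s ]) e (%ℕ-≋ x s))))

  ∣-≋ : ∀ {x y g} → x ≋ y [ g ] → g ∣ ∣ x ∣ → g ∣ ∣ y ∣
  ∣-≋ {x} {y} {g} (cg p) d = ZD.∣⇒∣ᵤ (subst (+ g ZD.∣_) (cancel-diff x y)
      (ZD.∣m∣n⇒∣m-n {+ g} {x} {x ℤ.- y} (ZD.∣ᵤ⇒∣ {+ g} {x} d) p))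
    where
    cancel-diff : ∀ x y → x ℤ.- (x ℤ.- y) ≡ y
    cancel-diff = solve-∀

  cop-≋ : ∀ {x y q} → + x ≋ + y [ q ] → Coprime x q → Coprime y q
  cop-≋ {x} {y} {q} e cx {d} (d∣y , d∣q) = cx (∣-≋ (≋-div d∣q (≋-sym e)) d∣y , d∣q)

  cop-*ʳ : ∀ {x m n} → Coprime x m → Coprime x n → Coprime x (m * n)
  cop-*ʳ {x} {m} {n} cm cn {d} (d∣x , d∣mn) = cn (d∣x , Cop.coprime-divisor dm d∣mn)
    where
    dm : Coprime d m
    dm {e} (e∣d , e∣m) = cm (∣-trans e∣d d∣x , e∣m)

  cop-*ˡ : ∀ {i n m} → Coprime i m → Coprime n m → Coprime (i * n) m
  cop-*ˡ ci cn = Cop.sym (cop-*ʳ (Cop.sym ci) (Cop.sym cn))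

  cop-divˡ : ∀ {x y q} → y ∣ x → Coprime x q → Coprime y q
  cop-divˡ y∣x c (d∣y , d∣q) = c (∣-trans d∣y y∣x , d∣q)

  cop-divʳ : ∀ {x y q} → y ∣ q → Coprime x q → Coprime x y
  cop-divʳ y∣q c (d∣x , d∣y) = c (d∣x , ∣-trans d∣y y∣q)

  cancel-unit : ∀ {n m i i'} → Coprime n m → i < m → i' < m → + (i * n) ≋ + (i' * n) [ m ] → i ≡ i'
  cancel-unit {n} {m} {i} {i'} c i<m i'<m (cg p) = ≋-small i<m i'<m (cg (ZD.∣ᵤ⇒∣ m∣i-i'))
    where
    factor : ∀ a b c → a ℤ.* c ℤ.- b ℤ.* c ≡ (a ℤ.- b) ℤ.* c
    factor = solve-∀
    m∣diff*n : m ∣ ∣ + i ℤ.- + i' ∣ * n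
    m∣diff*n = subst (m ∣_) (trans (cong ∣_∣ (trans (cong₂ ℤ._-_ (ℤP.pos-* i n) (ℤP.pos-* i' n))
      (factor (+ i) (+ i') (+ n)))) (ℤP.abs-* (+ i ℤ.- + i') (+ n))) (ZD.∣⇒∣ᵤ p)
    m∣i-i' : m ∣ ∣ + i ℤ.- + i' ∣
    m∣i-i' = Cop.coprime-divisor (Cop.sym c) (subst (m ∣_) (*-comm _ n) m∣diff*n)

  crt-injective : ∀ {m n i i' j j'} → Coprime m n → i < m → i' < m → j < n → j' < n →
    + (i * n + j * m) ≋ + (i' * n + j' * m) [ m * n ] → i ≡ i' × j ≡ j'
  crt-injective {m} {n} {i} {i'} {j} {j'} c i<m i'<m j<n j'<n e =
      cancel-unit (Cop.sym c) i<m i'<m (≋-trans (≋-sym (≋-addmul (i * n) j m)) (≋-trans mod-m (≋-addmul (i' * n) j' m)))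
    , cancel-unit c j<n j'<n (≋-trans (≋-sym (≋-addmulˡ (j * m) i n)) (≋-trans mod-n (≋-addmulˡ (j' * m) i' n)))
    where
    mod-m = ≋-div (m∣m*n n) e
    mod-n = ≋-div (n∣m*n m) e

  cop-lin-m : ∀ {i j n m} → Coprime n m → Coprime (i * n + j * m) m ⇔ Coprime i m
  cop-lin-m {i} {j} {n} {m} cn =
      (λ c → cop-divˡ (m∣m*n n) (cop-≋ (≋-addmul (i * n) j m) c))
    , (λ ci → cop-≋ (≋-sym (≋-addmul (i * n) j m)) (cop-*ˡ ci cn))

  cop-lin-n : ∀ {i j n m} → Coprime m n → Coprime (i * n + j * m) n ⇔ Coprime j n
  cop-lin-n {i} {j} {n} {m} cm =
      (λ c → cop-divˡ (m∣m*n m) (cop-≋ (≋-addmulˡ (j * m) i n) c))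
    , (λ cj → cop-≋ (≋-sym (≋-addmulˡ (j * m) i n)) (cop-*ˡ cj cm))

  gcd-idem : ∀ n → gcd n n ≡ n
  gcd-idem n = ∣-antisym (gcd[m,n]∣m n n) (gcd-greatest ∣-refl ∣-refl)

  gcd-of-divisor : ∀ {q q'} → q ∣ q' → gcd q q' ≡ q
  gcd-of-divisor {q} {q'} d = ∣-antisym (gcd[m,n]∣m q q') (gcd-greatest ∣-refl d)

  lcm-of-divisor : ∀ {q q'} → q ∣ q' → lcm q q' ≡ q'
  lcm-of-divisor {q} {q'} d = ∣-antisym (lcm-least d ∣-refl) (n∣lcm[m,n] q q')

  gcd-pos : ∀ x q' → 0 < q' → 0 < gcd x q'
  gcd-pos x q' q'>0 = n≢0⇒n>0 (λ e → <⇒≢ q'>0 (sym (gcd[m,n]≡0⇒n≡0 x e)))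

  cop-*-∣ : ∀ {a b x} → Coprime a b → a ∣ x → b ∣ x → a * b ∣ x
  cop-*-∣ {a} {b} {x} c (divides k eq) b∣x =
    subst (a * b ∣_) (sym eq) (subst (_∣ k * a) (*-comm b a) (*-monoˡ-∣ a b∣k))
    where
    b∣k : b ∣ k
    b∣k = Cop.coprime-divisor (Cop.sym c) (subst (b ∣_) (trans eq (*-comm k a)) b∣x)

  gcd-cop : ∀ {m n} q' → Coprime m n → Coprime (gcd m q') (gcd n q')
  gcd-cop {m} {n} q' c (d∣gm , d∣gn) = c (∣-trans d∣gm (gcd[m,n]∣m m q') , ∣-trans d∣gn (gcd[m,n]∣m n q'))

  gcd-mult : ∀ {m n} q' → Coprime m n → gcd (m * n) q' ≡ gcd m q' * gcd n q'
  gcd-mult {m} {n} q' c = ∣-antisym G∣gm*gn gm*gn∣G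
    where
    gm = gcd m q'
    gn = gcd n q'
    G = gcd (m * n) q'
    gm*gn∣G : gm * gn ∣ G
    gm*gn∣G = gcd-greatest (*-pres-∣ (gcd[m,n]∣m m q') (gcd[m,n]∣m n q'))
                           (cop-*-∣ (gcd-cop q' c) (gcd[m,n]∣n m q') (gcd[m,n]∣n n q'))
    G∣mn : G ∣ m * n
    G∣mn = gcd[m,n]∣m (m * n) q'
    G∣q' : G ∣ q'
    G∣q' = gcd[m,n]∣n (m * n) q'
    -- gm·gn = gcd(gm·n, gm·q') = gcd(gcd(n·m, n·q'), gcd(q'·m, q'·q'))
    G∣gm*n : G ∣ gm * n
    G∣gm*n = subst (G ∣_) (sym (trans (*-comm gm n) (c*gcd[m,n]≡gcd[cm,cn] n m q')))
               (gcd-greatest (subst (G ∣_) (*-comm m n) G∣mn) (∣-trans G∣q' (n∣m*n n)))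
    G∣gm*q' : G ∣ gm * q'
    G∣gm*q' = subst (G ∣_) (sym (trans (*-comm gm q') (c*gcd[m,n]≡gcd[cm,cn] q' m q')))
                (gcd-greatest (∣-trans G∣q' (m∣m*n m)) (∣-trans G∣q' (m∣m*n q')))
    G∣gm*gn : G ∣ gm * gn
    G∣gm*gn = subst (G ∣_) (sym (c*gcd[m,n]≡gcd[cm,cn] gm n q')) (gcd-greatest G∣gm*n G∣gm*q')

  lcm-form : ∀ x q' s → 0 < gcd x q' → x ≡ s * gcd x q' → lcm x q' ≡ q' * s
  lcm-form x q' s g>0 e = *-cancelˡ-≡ (lcm x q') (q' * s) (gcd x q') {{>-nonZero g>0}} (begin
      g * lcm x q' ≡⟨ gcd*lcm x q' ⟩
      x * q'       ≡⟨ cong (_* q') e ⟩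
      s * g * q'   ≡⟨ trans (*-assoc s g q') (trans (*-comm s (g * q')) (*-assoc g q' s)) ⟩
      g * (q' * s) ∎)
    where
    open ≡-Reasoning
    g = gcd x q'

  prime>1 : ∀ {p} → Prime p → 1 < p
  prime>1 {p} pr = nonTrivial⇒n>1 p {{prime⇒nonTrivial pr}}

  prime-∤⇒cop : ∀ {p x} → Prime p → ¬ (p ∣ x) → Coprime p x
  prime-∤⇒cop {p} {x} pr p∤x {d} (d∣p , d∣x) with prime⇒irreducible pr d∣p
  ... | inj₁ d≡1 = d≡1
  ... | inj₂ d≡p = ⊥-elim (p∤x (subst (_∣ x) d≡p d∣x))

  prime-cop-small : ∀ {p a} → Prime p → 0 < a → a < p → Coprime a p
  prime-cop-small {p} {suc a} pr _ a<p = Cop.sym (Cop.prime⇒coprime pr a<p)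

  prime-¬cop0 : ∀ {p} → Prime p → ¬ Coprime 0 p
  prime-¬cop0 {p} pr c = <⇒≢ (prime>1 pr) (sym (c (p ∣0 , ∣-refl)))

  gcd-square-∣ : ∀ {p q'} → Prime p → ¬ (p * p ∣ q') → gcd (p * p) q' ∣ p
  gcd-square-∣ {p} {q'} pr p²∤q' with p ∣? q'
  ... | no p∤q' = subst (_∣ p) (sym (Cop.coprime⇒gcd≡1 (cop-*ˡ c c))) (1∣ p)
    where c = prime-∤⇒cop pr p∤q'
  ... | yes (divides t q'≡tp) = subst (_∣ p) p≡gcd ∣-refl
    where
    p∤t : ¬ (p ∣ t)
    p∤t (divides u t≡up) = p²∤q' (divides u (trans q'≡tp (trans (cong (_* p) t≡up) (*-assoc u p p))))
    p≡gcd : p ≡ gcd (p * p) q'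
    p≡gcd = begin
      p                   ≡⟨ sym (*-identityʳ p) ⟩
      p * 1               ≡⟨ cong (p *_) (sym (Cop.coprime⇒gcd≡1 (prime-∤⇒cop pr p∤t))) ⟩
      p * gcd p t         ≡⟨ c*gcd[m,n]≡gcd[cm,cn] p p t ⟩
      gcd (p * p) (p * t) ≡⟨ cong (gcd (p * p)) (trans (*-comm p t) (sym q'≡tp)) ⟩
      gcd (p * p) q'      ∎
      where open ≡-Reasoning

  block-% : ∀ {i j n} .{{_ : NonZero n}} → j < n → (i * n + j) % n ≡ j
  block-% {i} {j} {n} j<n = trans (cong (_% n) (+-comm (i * n) j)) (trans ([m+kn]%n≡m%n j i n) (m<n⇒m%n≡m j<n))

  block-/ : ∀ {i j n} .{{_ : NonZero n}} → j < n → (i * n + j) / n ≡ i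
  block-/ {i} {j} {n} j<n = *-cancelʳ-≡ _ _ n (+-cancelˡ-≡ j _ _ (begin
      j + (x / n) * n     ≡⟨ cong (_+ (x / n) * n) (sym (block-% {i} {j} {n} j<n)) ⟩
      x % n + (x / n) * n ≡⟨ sym (m≡m%n+[m/n]*n x n) ⟩
      i * n + j           ≡⟨ +-comm (i * n) j ⟩
      j + i * n           ∎))
    where
    open ≡-Reasoning
    x = i * n + j

  block-decomposition : ∀ y n .{{_ : NonZero n}} → y ≡ (y / n) * n + y % n
  block-decomposition y n = trans (m≡m%n+[m/n]*n y n) (+-comm (y % n) _)

  bool-ext : ∀ {b₁ b₂ : Bool} → (b₁ ≡ true → b₂ ≡ true) → (b₂ ≡ true → b₁ ≡ true) → b₁ ≡ b₂
  bool-ext {false} {false} f g = refl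
  bool-ext {false} {true}  f g = g refl
  bool-ext {true}  {false} f g = sym (f refl)
  bool-ext {true}  {true}  f g = refl

  dec-true : ∀ {P : Set} (d : Dec P) → ⌊ d ⌋ ≡ true → P
  dec-true (yes p) _ = p

  true-dec : ∀ {P : Set} (d : Dec P) → P → ⌊ d ⌋ ≡ true
  true-dec (yes p) _ = refl
  true-dec (no ¬p) p = ⊥-elim (¬p p)

  dec-ext : ∀ {P Q : Set} (p : Dec P) (q : Dec Q) → (P → Q) → (Q → P) → ⌊ p ⌋ ≡ ⌊ q ⌋
  dec-ext p q f g = bool-ext (λ e → true-dec q (f (dec-true p e))) (λ e → true-dec p (g (dec-true q e)))

  -- unitᵇ q x tests gcd(x, q) = 1, exactly as in the definitions of φ and Σunits.
  unitᵇ : ℕ → ℕ → Bool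
  unitᵇ q x = gcd x q ≡ᵇ 1

  unitᵇ⇒cop : ∀ x q → unitᵇ q x ≡ true → Coprime x q
  unitᵇ⇒cop x q e = Cop.gcd≡1⇒coprime (≡ᵇ⇒≡ (gcd x q) 1 (subst T (sym e) _))

  cop⇒unitᵇ : ∀ x q → Coprime x q → unitᵇ q x ≡ true
  cop⇒unitᵇ x q c rewrite Cop.coprime⇒gcd≡1 c = refl

  unitᵇ-ext : ∀ {x q y r} → (Coprime x q → Coprime y r) → (Coprime y r → Coprime x q) → unitᵇ q x ≡ unitᵇ r y
  unitᵇ-ext {x} {q} {y} {r} f g =
    bool-ext (λ e → cop⇒unitᵇ y r (f (unitᵇ⇒cop x q e))) (λ e → cop⇒unitᵇ x q (g (unitᵇ⇒cop y r e)))

  unitᵇ-periodic : ∀ d k i → unitᵇ d (k * d + i) ≡ unitᵇ d i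
  unitᵇ-periodic d k i = unitᵇ-ext (cop-≋ (≋-addmulˡ i k d)) (cop-≋ (≋-sym (≋-addmulˡ i k d)))

  unitᵇ-square : ∀ p x → unitᵇ (p * p) x ≡ unitᵇ p x
  unitᵇ-square p x = unitᵇ-ext (cop-divʳ {x} (m∣m*n p)) (λ c → cop-*ʳ {x} c c)

  unitᵇ-mult : ∀ m n x .{{_ : NonZero m}} .{{_ : NonZero n}} →
    (unitᵇ (m * n) x ≡ true → unitᵇ m (x % m) ≡ true × unitᵇ n (x % n) ≡ true)
    × (unitᵇ m (x % m) ≡ true → unitᵇ n (x % n) ≡ true → unitᵇ (m * n) x ≡ true)
  unitᵇ-mult m n x =
      (λ e → let c = unitᵇ⇒cop x (m * n) e in
        cop⇒unitᵇ _ m (cop-≋ (≋-sym (%-≋ x m)) (cop-divʳ (m∣m*n n) c)) ,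
        cop⇒unitᵇ _ n (cop-≋ (≋-sym (%-≋ x n)) (cop-divʳ (n∣m*n m) c)))
    , (λ em en → cop⇒unitᵇ x (m * n) (cop-*ʳ (cop-≋ (%-≋ x m) (unitᵇ⇒cop _ m em)) (cop-≋ (%-≋ x n) (unitᵇ⇒cop _ n en))))


module Permutations where

  open import Data.Nat.Base
  open import Data.Nat.Properties
  open import Data.Product using (_×_; _,_)
  open import Data.Sum using (inj₁; inj₂)
  open import Data.Empty using (⊥; ⊥-elim)
  open import Relation.Nullary using (yes; no)
  open import Relation.Binary.PropositionalEquality
  import Data.Fin.Base as Fin using (Fin; toℕ; fromℕ<)
  import Data.Fin.Properties as Fin using (injective⇒≤; toℕ<n; toℕ-injective; fromℕ<-injective)

  InjectiveOn : ℕ → (ℕ → ℕ) → Set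
  InjectiveOn n ψ = (∀ y → y < n → ψ y < n) × (∀ y y' → y < n → y' < n → ψ y ≡ ψ y' → y ≡ y')

  no-injection-into-smaller : ∀ n (ψ : ℕ → ℕ) → (∀ y → y < suc n → ψ y < n) →
    (∀ y y' → y < suc n → y' < suc n → ψ y ≡ ψ y' → y ≡ y') → ⊥
  no-injection-into-smaller n ψ maps inj = 1+n≰n (Fin.injective⇒≤ f-injective)
    where
    f : Fin.Fin (suc n) → Fin.Fin n
    f i = Fin.fromℕ< (maps (Fin.toℕ i) (Fin.toℕ<n i))
    f-injective : ∀ {i j} → f i ≡ f j → i ≡ j
    f-injective {i} {j} e = Fin.toℕ-injective
      (inj _ _ (Fin.toℕ<n i) (Fin.toℕ<n j) (Fin.fromℕ<-injective _ _ (maps _ (Fin.toℕ<n i)) (maps _ (Fin.toℕ<n j)) e))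

  top-fixed : ∀ n ψ → InjectiveOn (suc n) ψ → (∀ y → y < n → ψ y ≢ n) → ψ n ≡ n
  top-fixed n ψ (maps , inj) n-not-hit with m<1+n⇒m<n∨m≡n (maps n ≤-refl)
  ... | inj₂ ψn≡n = ψn≡n
  ... | inj₁ ψn<n = ⊥-elim (no-injection-into-smaller n ψ below inj)
    where
    below : ∀ y → y < suc n → ψ y < n
    below y y<1+n with m<1+n⇒m<n∨m≡n y<1+n
    ... | inj₁ y<n  = ≤∧≢⇒< (≤-pred (maps y y<1+n)) (n-not-hit y y<n)
    ... | inj₂ refl = ψn<n

  restrict-injective : ∀ n ψ → InjectiveOn (suc n) ψ → (∀ y → y < n → ψ y ≢ n) → InjectiveOn n ψ
  restrict-injective n ψ (maps , inj) n-not-hit =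
      (λ y y<n → ≤∧≢⇒< (≤-pred (maps y (m<n⇒m<1+n y<n))) (n-not-hit y y<n))
    , (λ y y' y<n y'<n → inj y y' (m<n⇒m<1+n y<n) (m<n⇒m<1+n y'<n))

  redirect : (ℕ → ℕ) → ℕ → ℕ → ℕ → ℕ
  redirect ψ y₀ v y with y ≟ y₀
  ... | yes _ = v
  ... | no  _ = ψ y

  redirect-at : ∀ ψ y₀ v → redirect ψ y₀ v y₀ ≡ v
  redirect-at ψ y₀ v with y₀ ≟ y₀
  ... | yes _    = refl
  ... | no y₀≢y₀ = ⊥-elim (y₀≢y₀ refl)

  redirect-off : ∀ ψ y₀ v y → y ≢ y₀ → redirect ψ y₀ v y ≡ ψ y
  redirect-off ψ y₀ v y y≢y₀ with y ≟ y₀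
  ... | yes y≡y₀ = ⊥-elim (y≢y₀ y≡y₀)
  ... | no _     = refl

  redirect-injective : ∀ n ψ y₀ → InjectiveOn (suc n) ψ → y₀ < n → ψ y₀ ≡ n → InjectiveOn n (redirect ψ y₀ (ψ n))
  redirect-injective n ψ y₀ (maps , inj) y₀<n ψy₀≡n = maps′ , inj′
    where
    <n-off-y₀ : ∀ y → y < suc n → y ≢ y₀ → ψ y < n
    <n-off-y₀ y y<1+n y≢y₀ = ≤∧≢⇒< (≤-pred (maps y y<1+n))
      (λ ψy≡n → y≢y₀ (inj y y₀ y<1+n (m<n⇒m<1+n y₀<n) (trans ψy≡n (sym ψy₀≡n))))
    maps′ : ∀ y → y < n → redirect ψ y₀ (ψ n) y < n
    maps′ y y<n with y ≟ y₀
    ... | yes _   = <n-off-y₀ n ≤-refl (λ n≡y₀ → <-irrefl (sym n≡y₀) y₀<n)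
    ... | no y≢y₀ = <n-off-y₀ y (m<n⇒m<1+n y<n) y≢y₀
    top-not-hit : ∀ y → y < n → ψ n ≢ ψ y
    top-not-hit y y<n e = <-irrefl (sym (inj n y ≤-refl (m<n⇒m<1+n y<n) e)) y<n
    inj′ : ∀ y y' → y < n → y' < n → redirect ψ y₀ (ψ n) y ≡ redirect ψ y₀ (ψ n) y' → y ≡ y'
    inj′ y y' y<n y'<n e with y ≟ y₀ | y' ≟ y₀
    ... | yes y≡y₀ | yes y'≡y₀ = trans y≡y₀ (sym y'≡y₀)
    ... | yes _    | no _      = ⊥-elim (top-not-hit y' y'<n e)
    ... | no _     | yes _     = ⊥-elim (top-not-hit y y<n (sym e))
    ... | no _     | no _      = inj y y' (m<n⇒m<1+n y<n) (m<n⇒m<1+n y'<n) e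


module FiniteSums {c ℓ : Level} (R : Algebra.CommutativeSemiring c ℓ) where

  open Algebra.CommutativeSemiring R
  open import Data.Nat as ℕ using (ℕ; zero; suc; _<_)
  import Data.Nat.Properties as ℕP
  open import Data.Nat.DivMod using (_/_; _%_; m%n<n; m<n*o⇒m/o<n; m∣n⇒o%n%m≡o%m; [m+kn]%n≡m%n)
  open import Data.Nat.Divisibility using (m∣m*n; n∣m*n)
  open import Data.Nat.Coprimality as Cop using (Coprime)
  open import Data.Integer using (+_)
  open import Data.Bool using (Bool; true; false)
  open import Data.Product using (_×_; _,_; proj₁; proj₂)
  open import Relation.Nullary using (yes; no)
  open import Relation.Binary.PropositionalEquality as P using (_≡_; _≢_)
  open import Relation.Binary.Reasoning.Setoid setoid
  open import Algebra.Properties.CommutativeSemigroup +-commutativeSemigroup using (interchange; xy∙z≈xz∙y)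
  open Arithmetic
  open Permutations

  S : ℕ → (ℕ → Carrier) → Carrier
  S zero    f = 0#
  S (suc n) f = S n f + f n

  ind : Bool → Carrier
  ind true  = 1#
  ind false = 0#

  S-cong : ∀ n {f g : ℕ → Carrier} → (∀ k → k < n → f k ≈ g k) → S n f ≈ S n g
  S-cong zero    h = refl
  S-cong (suc n) h = +-cong (S-cong n (λ k k<n → h k (ℕP.m<n⇒m<1+n k<n))) (h n ℕP.≤-refl)

  S-cong′ : ∀ n {f g : ℕ → Carrier} → (∀ k → f k ≈ g k) → S n f ≈ S n g
  S-cong′ n h = S-cong n (λ k _ → h k)

  S-0 : ∀ n {f : ℕ → Carrier} → (∀ k → k < n → f k ≈ 0#) → S n f ≈ 0#
  S-0 zero    h = refl
  S-0 (suc n) h = trans (+-cong (S-0 n (λ k k<n → h k (ℕP.m<n⇒m<1+n k<n))) (h n ℕP.≤-refl)) (+-identityʳ 0#)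

  S-+ : ∀ n (f g : ℕ → Carrier) → S n (λ k → f k + g k) ≈ S n f + S n g
  S-+ zero    f g = sym (+-identityʳ 0#)
  S-+ (suc n) f g = trans (+-congʳ (S-+ n f g)) (interchange (S n f) (S n g) (f n) (g n))

  S-*ˡ : ∀ n (a : Carrier) (f : ℕ → Carrier) → a * S n f ≈ S n (λ k → a * f k)
  S-*ˡ zero    a f = zeroʳ a
  S-*ˡ (suc n) a f = trans (distribˡ a _ _) (+-congʳ (S-*ˡ n a f))

  S-*ʳ : ∀ n (a : Carrier) (f : ℕ → Carrier) → S n f * a ≈ S n (λ k → f k * a)
  S-*ʳ n a f = trans (*-comm _ a) (trans (S-*ˡ n a f) (S-cong′ n (λ k → *-comm a (f k))))

  S-const : ∀ n (a : Carrier) → S n (λ _ → a) ≈ S n (λ _ → 1#) * a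
  S-const n a = trans (S-cong′ n (λ _ → sym (*-identityˡ a))) (sym (S-*ʳ n a (λ _ → 1#)))

  S-shift : ∀ n (f : ℕ → Carrier) → S (suc n) f ≈ f 0 + S n (λ k → f (suc k))
  S-shift zero    f = trans (+-identityˡ _) (sym (+-identityʳ _))
  S-shift (suc n) f = trans (+-congʳ (S-shift n f)) (+-assoc _ _ _)

  S-rotate : ∀ n (f : ℕ → Carrier) → S n (λ k → f (suc k)) + f 0 ≈ S n f + f n
  S-rotate n f = trans (+-comm _ _) (sym (S-shift n f))

  S-split : ∀ m n (f : ℕ → Carrier) → S (m ℕ.+ n) f ≈ S m f + S n (λ k → f (m ℕ.+ k))
  S-split m zero    f = trans (reflexive (P.cong (λ t → S t f) (ℕP.+-identityʳ m))) (sym (+-identityʳ _))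
  S-split m (suc n) f = begin
    S (m ℕ.+ suc n) f                                 ≡⟨ P.cong (λ t → S t f) (ℕP.+-suc m n) ⟩
    S (m ℕ.+ n) f + f (m ℕ.+ n)                       ≈⟨ +-congʳ (S-split m n f) ⟩
    (S m f + S n (λ k → f (m ℕ.+ k))) + f (m ℕ.+ n)   ≈⟨ +-assoc _ _ _ ⟩
    S m f + S (suc n) (λ k → f (m ℕ.+ k))             ∎

  S-block : ∀ s d (f : ℕ → Carrier) → S (s ℕ.* d) f ≈ S s (λ k → S d (λ i → f (k ℕ.* d ℕ.+ i)))
  S-block zero    d f = refl
  S-block (suc s) d f = begin
    S (d ℕ.+ s ℕ.* d) f                                               ≈⟨ S-split d (s ℕ.* d) f ⟩
    S d f + S (s ℕ.* d) (λ j → f (d ℕ.+ j))                           ≈⟨ +-congˡ (S-block s d (λ j → f (d ℕ.+ j))) ⟩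
    S d f + S s (λ k → S d (λ i → f (d ℕ.+ (k ℕ.* d ℕ.+ i))))         ≈⟨ +-congˡ (S-cong′ s (λ k → S-cong′ d (λ i →
                                                                           reflexive (P.cong f (P.sym (ℕP.+-assoc d (k ℕ.* d) i)))))) ⟩
    S d f + S s (λ k → S d (λ i → f (suc k ℕ.* d ℕ.+ i)))             ≈⟨ sym (S-shift s _) ⟩
    S (suc s) (λ k → S d (λ i → f (k ℕ.* d ℕ.+ i)))                   ∎

  S-swap : ∀ m n (f : ℕ → ℕ → Carrier) → S m (λ i → S n (λ j → f i j)) ≈ S n (λ j → S m (λ i → f i j))
  S-swap zero    n f = sym (S-0 n (λ _ _ → refl))
  S-swap (suc m) n f = trans (+-congʳ (S-swap m n f)) (sym (S-+ n _ _))

  S-product : ∀ m n (f g : ℕ → Carrier) → S m f * S n g ≈ S m (λ i → S n (λ j → f i * g j))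
  S-product m n f g = trans (S-*ʳ m _ f) (S-cong′ m (λ i → S-*ˡ n (f i) g))

  S-single : ∀ n x₀ (f : ℕ → Carrier) → x₀ < n → (∀ k → k < n → k ≢ x₀ → f k ≈ 0#) → S n f ≈ f x₀
  S-single (suc n) x₀ f x₀<n h with x₀ ℕ.≟ n
  ... | yes P.refl = trans (+-congʳ (S-0 n (λ k k<n → h k (ℕP.m<n⇒m<1+n k<n) (λ e → ℕP.<-irrefl e k<n)))) (+-identityˡ _)
  ... | no x₀≢n = trans (+-cong (S-single n x₀ f (ℕP.≤∧≢⇒< (ℕP.≤-pred x₀<n) x₀≢n) (λ k k<n → h k (ℕP.m<n⇒m<1+n k<n)))
                                (h n ℕP.≤-refl (λ e → x₀≢n (P.sym e))))
                        (+-identityʳ _)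

  S-update : ∀ n x₀ (g h : ℕ → Carrier) → x₀ < n → (∀ k → k < n → k ≢ x₀ → g k ≈ h k) →
    S n g + h x₀ ≈ S n h + g x₀
  S-update (suc n) x₀ g h x₀<n e with x₀ ℕ.≟ n
  ... | yes P.refl = begin
     (S n g + g n) + h n ≈⟨ +-assoc _ _ _ ⟩
     S n g + (g n + h n) ≈⟨ +-cong (S-cong n (λ k k<n → e k (ℕP.m<n⇒m<1+n k<n) (λ q → ℕP.<-irrefl q k<n))) (+-comm _ _) ⟩
     S n h + (h n + g n) ≈⟨ sym (+-assoc _ _ _) ⟩
     (S n h + h n) + g n ∎
  ... | no x₀≢n = begin
     (S n g + g n) + h x₀ ≈⟨ xy∙z≈xz∙y (S n g) (g n) (h x₀) ⟩
     (S n g + h x₀) + g n ≈⟨ +-cong (S-update n x₀ g h (ℕP.≤∧≢⇒< (ℕP.≤-pred x₀<n) x₀≢n) (λ k k<n → e k (ℕP.m<n⇒m<1+n k<n)))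
                                   (e n ℕP.≤-refl (λ q → x₀≢n (P.sym q))) ⟩
     (S n h + g x₀) + h n ≈⟨ xy∙z≈xz∙y (S n h) (g x₀) (h n) ⟩
     (S n h + h n) + g x₀ ∎

  -- Sums are invariant under reindexing along a permutation of [0, n).
  -- Induction on n: the preimage y₀ of the top index n is exchanged with n.
  S-reindex : ∀ n (ψ : ℕ → ℕ) → InjectiveOn n ψ → ∀ f → S n (λ y → f (ψ y)) ≈ S n f
  S-reindex zero    ψ _     f = refl
  S-reindex (suc n) ψ ψ-inj f with ℕP.anyUpTo? (λ y → ψ y ℕ.≟ n) n
  ... | yes (y₀ , y₀<n , ψy₀≡n) = begin
      S n (λ y → f (ψ y)) + f (ψ n)    ≈⟨ +-congˡ (reflexive (P.cong f (P.sym (redirect-at ψ y₀ (ψ n))))) ⟩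
      S n (λ y → f (ψ y)) + f (ψ′ y₀)  ≈⟨ sym (S-update n y₀ (λ y → f (ψ′ y)) (λ y → f (ψ y)) y₀<n
                                              (λ k _ k≢y₀ → reflexive (P.cong f (redirect-off ψ y₀ (ψ n) k k≢y₀)))) ⟩
      S n (λ y → f (ψ′ y)) + f (ψ y₀)  ≈⟨ +-cong (S-reindex n ψ′ (redirect-injective n ψ y₀ ψ-inj y₀<n ψy₀≡n) f)
                                              (reflexive (P.cong f ψy₀≡n)) ⟩
      S n f + f n                      ∎
    where
    ψ′ = redirect ψ y₀ (ψ n)
  ... | no n-not-hit = +-cong (S-reindex n ψ (restrict-injective n ψ ψ-inj not-hit) f)
                              (reflexive (P.cong f (top-fixed n ψ ψ-inj not-hit)))
    where
    not-hit : ∀ y → y < n → ψ y ≢ n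
    not-hit y y<n ψy≡n = n-not-hit (y , y<n , ψy≡n)

  -- Multiplying the index by a unit modulo m permutes [0, m).
  S-unit-reindex : ∀ m n .{{_ : ℕ.NonZero m}} → Coprime n m → (G : ℕ → Carrier) →
    S m (λ i → G ((i ℕ.* n) % m)) ≈ S m G
  S-unit-reindex m n c G = S-reindex m (λ i → (i ℕ.* n) % m) ((λ y _ → m%n<n (y ℕ.* n) m) , injective) G
    where
    injective : ∀ y y' → y < m → y' < m → (y ℕ.* n) % m ≡ (y' ℕ.* n) % m → y ≡ y'
    injective y y' y<m y'<m e = cancel-unit c y<m y'<m
      (≋-trans (≋-sym (%-≋ (y ℕ.* n) m)) (≋-trans (≋-reflexive (P.cong +_ e)) (%-≋ (y' ℕ.* n) m)))

  -- Chinese remainder theorem for sums: for coprime m, n the residues of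
  -- i·n + j·m (i < m, j < n) run once through [0, m·n).
  S-crt : ∀ m n .{{_ : ℕ.NonZero m}} .{{_ : ℕ.NonZero n}} .{{_ : ℕ.NonZero (m ℕ.* n)}} → Coprime m n →
    (Φ : ℕ → Carrier) → S (m ℕ.* n) Φ ≈ S m (λ i → S n (λ j → Φ ((i ℕ.* n ℕ.+ j ℕ.* m) % (m ℕ.* n))))
  S-crt m n c Φ = begin
    S M Φ                                        ≈⟨ sym (S-reindex M ψ ((λ y _ → m%n<n (crt y) M) , injective) Φ) ⟩
    S M (λ y → Φ (ψ y))                          ≈⟨ S-block m n (λ y → Φ (ψ y)) ⟩
    S m (λ i → S n (λ j → Φ (ψ (i ℕ.* n ℕ.+ j)))) ≈⟨ S-cong m (λ i _ → S-cong n (λ j j<n → reflexive (P.cong (λ t → Φ (t % M))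
                                                      (P.cong₂ (λ a b → a ℕ.* n ℕ.+ b ℕ.* m) (block-/ {i} {j} {n} j<n) (block-% {i} {j} {n} j<n))))) ⟩
    S m (λ i → S n (λ j → Φ ((i ℕ.* n ℕ.+ j ℕ.* m) % M))) ∎
    where
    M = m ℕ.* n
    crt : ℕ → ℕ
    crt y = (y / n) ℕ.* n ℕ.+ (y % n) ℕ.* m
    ψ : ℕ → ℕ
    ψ y = crt y % M
    injective : ∀ y y' → y < M → y' < M → ψ y ≡ ψ y' → y ≡ y'
    injective y y' y<M y'<M e = P.trans (block-decomposition y n)
        (P.trans (P.cong₂ (λ a b → a ℕ.* n ℕ.+ b) (proj₁ same) (proj₂ same)) (P.sym (block-decomposition y' n)))
      where
      same = crt-injective c (m<n*o⇒m/o<n y<M) (m<n*o⇒m/o<n y'<M) (m%n<n y n) (m%n<n y' n)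
        (≋-trans (≋-sym (%-≋ (crt y) M)) (≋-trans (≋-reflexive (P.cong +_ e)) (%-≋ (crt y') M)))

  S-crt-product : ∀ m n .{{_ : ℕ.NonZero m}} .{{_ : ℕ.NonZero n}} .{{_ : ℕ.NonZero (m ℕ.* n)}} → Coprime m n →
    (Φ G H : ℕ → Carrier) → (∀ x → x < m ℕ.* n → Φ x ≈ G (x % m) * H (x % n)) →
    S (m ℕ.* n) Φ ≈ S m G * S n H
  S-crt-product m n c Φ G H factors = begin
    S M Φ                                                         ≈⟨ S-crt m n c Φ ⟩
    S m (λ i → S n (λ j → Φ (X i j % M)))                          ≈⟨ S-cong′ m (λ i → S-cong′ n (λ j → at-crt i j)) ⟩
    S m (λ i → S n (λ j → G ((i ℕ.* n) % m) * H ((j ℕ.* m) % n))) ≈⟨ sym (S-product m n _ _) ⟩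
    S m (λ i → G ((i ℕ.* n) % m)) * S n (λ j → H ((j ℕ.* m) % n)) ≈⟨ *-cong (S-unit-reindex m n (Cop.sym c) G) (S-unit-reindex n m c H) ⟩
    S m G * S n H                                                 ∎
    where
    M = m ℕ.* n
    X : ℕ → ℕ → ℕ
    X i j = i ℕ.* n ℕ.+ j ℕ.* m
    at-crt : ∀ i j → Φ (X i j % M) ≈ G ((i ℕ.* n) % m) * H ((j ℕ.* m) % n)
    at-crt i j = trans (factors _ (m%n<n (X i j) M)) (*-cong (reflexive (P.cong G mod-m)) (reflexive (P.cong H mod-n)))
      where
      mod-m : X i j % M % m ≡ (i ℕ.* n) % m
      mod-m = P.trans (m∣n⇒o%n%m≡o%m m M (X i j) (m∣m*n n)) ([m+kn]%n≡m%n (i ℕ.* n) j m)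
      mod-n : X i j % M % n ≡ (j ℕ.* m) % n
      mod-n = P.trans (m∣n⇒o%n%m≡o%m n M (X i j) (n∣m*n m))
                (P.trans (P.cong (_% n) (ℕP.+-comm (i ℕ.* n) (j ℕ.* m))) ([m+kn]%n≡m%n (j ℕ.* m) i n))

  ind-∧ : ∀ {b b₁ b₂ : Bool} → (b ≡ true → b₁ ≡ true × b₂ ≡ true) → (b₁ ≡ true → b₂ ≡ true → b ≡ true) →
    ind b ≈ ind b₁ * ind b₂
  ind-∧ {true}  {true}  {true}  f g = sym (*-identityˡ 1#)
  ind-∧ {true}  {true}  {false} f g with () ← proj₂ (f P.refl)
  ind-∧ {true}  {false} {b₂}    f g with () ← proj₁ (f P.refl)
  ind-∧ {false} {true}  {true}  f g with () ← g P.refl P.refl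
  ind-∧ {false} {true}  {false} f g = sym (zeroʳ 1#)
  ind-∧ {false} {false} {b₂}    f g = sym (zeroˡ _)

  ind-unitᵇ-mult : ∀ m n x .{{_ : ℕ.NonZero m}} .{{_ : ℕ.NonZero n}} →
    ind (unitᵇ (m ℕ.* n) x) ≈ ind (unitᵇ m (x % m)) * ind (unitᵇ n (x % n))
  ind-unitᵇ-mult m n x = ind-∧ (proj₁ (unitᵇ-mult m n x)) (proj₂ (unitᵇ-mult m n x))


module Totient where

  open import Data.Nat.Base
  open import Data.Nat.Properties
  open import Data.Nat.Divisibility using (_∣_; m∣m*n; ∣-trans; quotient; m∣n⇒n≡quotient*m)
  open import Data.Nat.GCD using (gcd; gcd-identityˡ; gcd-zeroˡ; gcd[m,n]∣m; gcd[m,n]∣n)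
  open import Data.Nat.LCM using (lcm)
  open import Data.Nat.Coprimality as Cop using (Coprime)
  open import Data.Nat.Induction using (<-rec)
  open import Data.Bool using (true; false; if_then_else_)
  open import Data.Product using (_,_)
  open import Relation.Nullary using (yes; no)
  open import Relation.Binary.PropositionalEquality
  open import Data.Nat.Tactic.RingSolver using (solve-∀)
  open FiniteSums +-*-commutativeSemiring
  open Arithmetic
  open ≡-Reasoning

  sumℕ≡S : ∀ n f → sumℕ n f ≡ S n (λ k → f (suc k))
  sumℕ≡S zero    f = refl
  sumℕ≡S (suc n) f = cong (_+ f (suc n)) (sumℕ≡S n f)

  if≡ind : ∀ b → (if b then 1 else 0) ≡ ind b
  if≡ind true  = refl
  if≡ind false = refl

  -- φ(n) = Σ_{0 ≤ r < n} [gcd(r, n) = 1]; the summand at r = n equals the one at r = 0.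
  φ-as-S : ∀ n → φ n ≡ S n (λ r → ind (unitᵇ n r))
  φ-as-S n = begin
    φ n                       ≡⟨ +-cancelʳ-≡ (g 0) _ _ (begin
        φ n + g 0                 ≡⟨ cong (_+ g 0) (sumℕ≡S n g) ⟩
        S n (λ k → g (suc k)) + g 0 ≡⟨ S-rotate n g ⟩
        S n g + g n               ≡⟨ cong (λ t → S n g + (if t ≡ᵇ 1 then 1 else 0)) (trans (gcd-idem n) (sym (gcd-identityˡ n))) ⟩
        S n g + g 0               ∎) ⟩
    S n g                     ≡⟨ S-cong′ n (λ r → if≡ind (unitᵇ n r)) ⟩
    S n (λ r → ind (unitᵇ n r)) ∎
    where
    g : ℕ → ℕ
    g r = if unitᵇ n r then 1 else 0

  -- φ(n) ≥ 1 for n ≥ 1, witnessed by k = 1.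
  φ-pos : ∀ n → 0 < n → 0 < φ n
  φ-pos (suc n) _ = <-≤-trans first-term (sumℕ-mono n)
    where
    f : ℕ → ℕ
    f k = if gcd k (suc n) ≡ᵇ 1 then 1 else 0
    first-term : 0 < sumℕ 1 f
    first-term rewrite gcd-zeroˡ (suc n) = s≤s z≤n
    sumℕ-mono : ∀ n → sumℕ 1 f ≤ sumℕ (suc n) f
    sumℕ-mono zero    = ≤-refl
    sumℕ-mono (suc n) = ≤-trans (sumℕ-mono n) (m≤m+n _ _)

  -- φ is multiplicative, by the CRT splitting of the unit indicator.
  φ-mult : ∀ m n → 0 < m → 0 < n → Coprime m n → φ (m * n) ≡ φ m * φ n
  φ-mult m@(suc _) n@(suc _) _ _ c = begin
    φ (m * n)                                          ≡⟨ φ-as-S (m * n) ⟩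
    S (m * n) (λ r → ind (unitᵇ (m * n) r))            ≡⟨ S-crt-product m n c _ _ _ (λ x _ → ind-unitᵇ-mult m n x) ⟩
    S m (λ r → ind (unitᵇ m r)) * S n (λ r → ind (unitᵇ n r)) ≡⟨ sym (cong₂ _*_ (φ-as-S m) (φ-as-S n)) ⟩
    φ m * φ n                                          ∎

  S-ones : ∀ n → S n (λ _ → 1) ≡ n
  S-ones zero    = refl
  S-ones (suc n) = trans (cong (_+ 1) (S-ones n)) (+-comm n 1)

  -- If y ∣ X then the units modulo X·y are the y translates of the units modulo X.
  φ-scale : ∀ X y → 0 < X → y ∣ X → φ (X * y) ≡ y * φ X
  φ-scale X@(suc _) y _ y∣X = begin
    φ (X * y)                                          ≡⟨ φ-as-S (X * y) ⟩
    S (X * y) (λ z → ind (unitᵇ (X * y) z))            ≡⟨ S-cong′ (X * y) (λ z → cong ind (unitᵇ-ext (cop-divʳ {z} (m∣m*n y))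
                                                            (λ c → cop-*ʳ {z} c (cop-divʳ y∣X c)))) ⟩
    S (X * y) (λ z → ind (unitᵇ X z))                  ≡⟨ cong (λ t → S t (λ z → ind (unitᵇ X z))) (*-comm X y) ⟩
    S (y * X) (λ z → ind (unitᵇ X z))                  ≡⟨ S-block y X _ ⟩
    S y (λ k → S X (λ i → ind (unitᵇ X (k * X + i))))  ≡⟨ S-cong′ y (λ k → S-cong′ X (λ i → cong ind (unitᵇ-periodic X k i))) ⟩
    S y (λ _ → S X (λ i → ind (unitᵇ X i)))            ≡⟨ S-const y _ ⟩
    S y (λ _ → 1) * S X (λ i → ind (unitᵇ X i))        ≡⟨ cong₂ _*_ (S-ones y) (sym (φ-as-S X)) ⟩
    y * φ X                                            ∎

  private
    pos-* : ∀ {a b} → 0 < a → 0 < b → 0 < a * b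
    pos-* {a} {b} a>0 b>0 = *-mono-< {0} {a} {0} {b} a>0 b>0

  ScaleMult : ℕ → ℕ → ℕ → Set
  ScaleMult Q s₁ s₂ = φ (Q * s₁ * s₂) * φ Q ≡ φ (Q * s₁) * φ (Q * s₂)

  -- It holds when s₁ is also coprime to Q: everything splits by φ-mult.
  scale-mult-coprime : ∀ Q s₁ s₂ → 0 < Q → 0 < s₁ → 0 < s₂ → Coprime s₁ Q → Coprime s₁ s₂ → ScaleMult Q s₁ s₂
  scale-mult-coprime Q s₁ s₂ Q>0 s₁>0 s₂>0 s₁⊥Q s₁⊥s₂ = begin
    φ (Q * s₁ * s₂) * φ Q           ≡⟨ cong (λ t → φ t * φ Q) (rearrange Q s₁ s₂) ⟩
    φ (s₁ * (Q * s₂)) * φ Q         ≡⟨ cong (_* φ Q) (φ-mult s₁ (Q * s₂) s₁>0 (pos-* Q>0 s₂>0) (cop-*ʳ s₁⊥Q s₁⊥s₂)) ⟩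
    φ s₁ * φ (Q * s₂) * φ Q         ≡⟨ swap-last (φ s₁) (φ (Q * s₂)) (φ Q) ⟩
    φ s₁ * φ Q * φ (Q * s₂)         ≡⟨ cong (_* φ (Q * s₂)) (sym (trans (cong φ (*-comm Q s₁)) (φ-mult s₁ Q s₁>0 Q>0 s₁⊥Q))) ⟩
    φ (Q * s₁) * φ (Q * s₂)         ∎
    where
    rearrange : ∀ Q s₁ s₂ → Q * s₁ * s₂ ≡ s₁ * (Q * s₂)
    rearrange = solve-∀
    swap-last : ∀ a b c → a * b * c ≡ a * c * b
    swap-last = solve-∀

  -- It survives multiplying s₁ by a divisor g of Q: both φ(Q·t·g·…) pick up a factor g.
  scale-mult-absorb : ∀ Q t g s₂ → 0 < Q → 0 < t → 0 < s₂ → g ∣ Q → ScaleMult Q t s₂ → ScaleMult Q (t * g) s₂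
  scale-mult-absorb Q t g s₂ Q>0 t>0 s₂>0 g∣Q identity = begin
    φ (Q * (t * g) * s₂) * φ Q      ≡⟨ cong (λ u → φ u * φ Q) (pull-g Q t s₂ g) ⟩
    φ (Q * t * s₂ * g) * φ Q        ≡⟨ cong (_* φ Q) (φ-scale (Q * t * s₂) g (pos-* (pos-* Q>0 t>0) s₂>0)
                                          (∣-trans g∣Q (∣-trans (m∣m*n t) (m∣m*n s₂)))) ⟩
    g * φ (Q * t * s₂) * φ Q        ≡⟨ *-assoc g _ _ ⟩
    g * (φ (Q * t * s₂) * φ Q)      ≡⟨ cong (g *_) identity ⟩
    g * (φ (Q * t) * φ (Q * s₂))    ≡⟨ sym (*-assoc g _ _) ⟩
    g * φ (Q * t) * φ (Q * s₂)      ≡⟨ cong (_* φ (Q * s₂)) (sym (φ-scale (Q * t) g (pos-* Q>0 t>0) (∣-trans g∣Q (m∣m*n t)))) ⟩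
    φ (Q * t * g) * φ (Q * s₂)      ≡⟨ cong (λ u → φ u * φ (Q * s₂)) (*-assoc Q t g) ⟩
    φ (Q * (t * g)) * φ (Q * s₂)    ∎
    where
    pull-g : ∀ Q t s₂ g → Q * (t * g) * s₂ ≡ Q * t * s₂ * g
    pull-g = solve-∀

  -- Strong induction on s₁: if gcd(s₁, Q) = g > 1 then s₁ = t·g with t < s₁.
  φ-scale-mult : ∀ s₁ Q s₂ → 0 < Q → 0 < s₁ → 0 < s₂ → Coprime s₁ s₂ → ScaleMult Q s₁ s₂
  φ-scale-mult = <-rec _ step
    where
    step : ∀ s₁ → (∀ {t} → t < s₁ → ∀ Q s₂ → 0 < Q → 0 < t → 0 < s₂ → Coprime t s₂ → ScaleMult Q t s₂) →
           ∀ Q s₂ → 0 < Q → 0 < s₁ → 0 < s₂ → Coprime s₁ s₂ → ScaleMult Q s₁ s₂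
    step s₁ IH Q s₂ Q>0 s₁>0 s₂>0 s₁⊥s₂ with gcd s₁ Q ≟ 1
    ... | yes g≡1 = scale-mult-coprime Q s₁ s₂ Q>0 s₁>0 s₂>0 (Cop.gcd≡1⇒coprime g≡1) s₁⊥s₂
    ... | no g≢1 = subst (λ z → ScaleMult Q z s₂) (sym s₁≡t*g)
        (scale-mult-absorb Q t g s₂ Q>0 t>0 s₂>0 (gcd[m,n]∣n s₁ Q)
          (IH t<s₁ Q s₂ Q>0 t>0 s₂>0 (cop-divˡ (m∣m*n g) (subst (λ z → Coprime z s₂) s₁≡t*g s₁⊥s₂))))
      where
      g = gcd s₁ Q
      t = quotient (gcd[m,n]∣m s₁ Q)
      s₁≡t*g : s₁ ≡ t * g
      s₁≡t*g = m∣n⇒n≡quotient*m (gcd[m,n]∣m s₁ Q)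
      t>0 : 0 < t
      t>0 = n≢0⇒n>0 (λ t≡0 → <-irrefl (sym (trans s₁≡t*g (cong (_* g) t≡0))) s₁>0)
      g>1 : 1 < g
      g>1 = ≤∧≢⇒< (gcd-pos s₁ Q Q>0) (λ 1≡g → g≢1 (sym 1≡g))
      t<s₁ : t < s₁
      t<s₁ = subst (t <_) (sym s₁≡t*g) (subst (_< t * g) (*-identityʳ t) (*-monoʳ-< t {{>-nonZero t>0}} g>1))

  cofactor : ℕ → ℕ → ℕ
  cofactor x q' = quotient (gcd[m,n]∣m x q')

  cofactor-spec : ∀ x q' → x ≡ cofactor x q' * gcd x q'
  cofactor-spec x q' = m∣n⇒n≡quotient*m (gcd[m,n]∣m x q')

  cofactor-pos : ∀ x q' → 0 < x → 0 < cofactor x q'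
  cofactor-pos x q' x>0 = n≢0⇒n>0 (λ s≡0 → <-irrefl (sym (trans (cofactor-spec x q') (cong (_* gcd x q') s≡0))) x>0)

  -- The identity behind the multiplicativity of q ↦ φ(q') · q / φ(lcm(q, q')):
  -- φ(lcm(m·n, q')) · φ(q') = φ(lcm(m, q')) · φ(lcm(n, q')) for coprime m, n.
  φ-lcm-mult : ∀ m n q' → 0 < m → 0 < n → 0 < q' → Coprime m n →
    φ (lcm (m * n) q') * φ q' ≡ φ (lcm m q') * φ (lcm n q')
  φ-lcm-mult m n q' m>0 n>0 q'>0 c = begin
    φ (lcm (m * n) q') * φ q'       ≡⟨ cong (λ l → φ l * φ q') lcm-mn ⟩
    φ (q' * sm * sn) * φ q'         ≡⟨ φ-scale-mult sm q' sn q'>0 (cofactor-pos m q' m>0) (cofactor-pos n q' n>0) sm⊥sn ⟩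
    φ (q' * sm) * φ (q' * sn)       ≡⟨ sym (cong₂ (λ u v → φ u * φ v) (lcm-form m q' sm (gcd-pos m q' q'>0) (cofactor-spec m q'))
                                                                     (lcm-form n q' sn (gcd-pos n q' q'>0) (cofactor-spec n q'))) ⟩
    φ (lcm m q') * φ (lcm n q')     ∎
    where
    sm = cofactor m q'
    sn = cofactor n q'
    sm⊥sn : Coprime sm sn
    sm⊥sn = cop-divˡ (m∣m*n (gcd m q')) (subst (λ z → Coprime z sn) (cofactor-spec m q')
              (Cop.sym (cop-divˡ (m∣m*n (gcd n q')) (subst (λ z → Coprime z m) (cofactor-spec n q') (Cop.sym c)))))
    interchange : ∀ a b c d → a * b * (c * d) ≡ a * c * (b * d)
    interchange = solve-∀
    mn≡ : m * n ≡ (sm * sn) * gcd (m * n) q'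
    mn≡ = trans (cong₂ _*_ (cofactor-spec m q') (cofactor-spec n q'))
            (trans (interchange sm (gcd m q') sn (gcd n q')) (cong ((sm * sn) *_) (sym (gcd-mult q' c))))
    lcm-mn : lcm (m * n) q' ≡ q' * sm * sn
    lcm-mn = trans (lcm-form (m * n) q' (sm * sn) (gcd-pos (m * n) q' q'>0) mn≡) (sym (*-assoc q' sm sn))


module Cyclotomic {c ℓ : Level} (F : CycloField c ℓ) where

  open CF F
  open import Data.Nat.GCD using (gcd-identityˡ)
  open FiniteSums commutativeSemiring
  open Arithmetic
  open import Data.Nat as ℕ using (ℕ; zero; suc; _<_; NonZero)
  import Data.Nat.Properties as ℕP
  open import Data.Nat.DivMod using (_/_; _%_; m≡m%n+[m/n]*n)
  open import Data.Nat.Divisibility using (_∣_)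
  open import Data.Integer as ℤ using (ℤ; +_; ∣_∣)
  import Data.Integer.Properties as ℤP
  import Data.Integer.DivMod as ℤDM
  open import Data.Integer.Tactic.RingSolver using (solve-∀)
  open import Data.Bool using (true; false; if_then_else_)
  open import Data.Product using (_,_)
  open import Relation.Nullary using (¬_)
  open import Relation.Binary.PropositionalEquality as P using (_≡_; _≢_)
  open import Relation.Binary.Reasoning.Setoid setoid
  open import Algebra.Solver.Ring.NaturalCoefficients.Default commutativeSemiring
  open import Algebra.Properties.CommutativeSemigroup *-commutativeSemigroup using (interchange)
  open import Algebra.Properties.Ring ring using (-‿+-comm; -0#≈0#; -1*x≈-x)
  open import Algebra.Properties.AbelianGroup +-abelianGroup using (inverseˡ-unique; quasigroup)
  open import Algebra.Properties.Quasigroup quasigroup using (cancelʳ)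
  open import Data.Nat.Primality using (Prime)
  open import Data.Empty using (⊥-elim)

  ι-+ : ∀ a b → ι (a ℕ.+ b) ≈ ι a + ι b
  ι-+ zero    b = sym (+-identityˡ _)
  ι-+ (suc a) b = trans (+-congˡ (ι-+ a b)) (sym (+-assoc _ _ _))

  ι-* : ∀ a b → ι (a ℕ.* b) ≈ ι a * ι b
  ι-* zero    b = sym (zeroˡ _)
  ι-* (suc a) b = begin
    ι (b ℕ.+ a ℕ.* b)      ≈⟨ ι-+ b (a ℕ.* b) ⟩
    ι b + ι (a ℕ.* b)      ≈⟨ +-cong (sym (*-identityˡ _)) (ι-* a b) ⟩
    1# * ι b + ι a * ι b   ≈⟨ sym (distribʳ _ _ _) ⟩
    (1# + ι a) * ι b       ∎

  ι-1 : ι 1 ≈ 1#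
  ι-1 = +-identityʳ 1#

  inverse-unique : ∀ {x y z} → x * y ≈ 1# → x * z ≈ 1# → y ≈ z
  inverse-unique {x} {y} {z} xy xz = begin
    y             ≈⟨ sym (*-identityˡ y) ⟩
    1# * y        ≈⟨ *-congʳ (sym xz) ⟩
    (x * z) * y   ≈⟨ solve 3 (λ x y z → (x :* z) :* y := (x :* y) :* z) refl x y z ⟩
    (x * y) * z   ≈⟨ *-congʳ xy ⟩
    1# * z        ≈⟨ *-identityˡ z ⟩
    z             ∎

  recip-inverse : ∀ n .{{_ : NonZero n}} → ι n * recip n ≈ 1#
  recip-inverse (suc n) = recip-spec n

  recip-unique : ∀ n .{{_ : NonZero n}} {z} → ι n * z ≈ 1# → recip n ≈ z
  recip-unique n = inverse-unique (recip-inverse n)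

  recip-* : ∀ x y .{{_ : NonZero x}} .{{_ : NonZero y}} → recip (x ℕ.* y) ≈ recip x * recip y
  recip-* x y = recip-unique (x ℕ.* y) {{ℕP.m*n≢0 x y}} (begin
    ι (x ℕ.* y) * (recip x * recip y)           ≈⟨ *-congʳ (ι-* x y) ⟩
    ι x * ι y * (recip x * recip y)             ≈⟨ interchange _ _ _ _ ⟩
    (ι x * recip x) * (ι y * recip y)           ≈⟨ *-cong (recip-inverse x) (recip-inverse y) ⟩
    1# * 1#                                     ≈⟨ *-identityˡ 1# ⟩
    1#                                          ∎)

  *-cancel-nonzero : ∀ {x y z} → ¬ (x ≈ 0#) → x * y ≈ x * z → y ≈ z
  *-cancel-nonzero {x} {y} {z} x≉0 e with inverses x x≉0
  ... | u , xu≈1 = begin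
    y             ≈⟨ sym (*-identityˡ y) ⟩
    1# * y        ≈⟨ *-congʳ (sym xu≈1) ⟩
    (x * u) * y   ≈⟨ solve 3 (λ x y u → (x :* u) :* y := u :* (x :* y)) refl x y u ⟩
    u * (x * y)   ≈⟨ *-congˡ e ⟩
    u * (x * z)   ≈⟨ solve 3 (λ x z u → u :* (x :* z) := (x :* u) :* z) refl x z u ⟩
    (x * u) * z   ≈⟨ *-congʳ xu≈1 ⟩
    1# * z        ≈⟨ *-identityˡ z ⟩
    z             ∎

  add-cancel : ∀ {a b c} → a + c ≈ b + c → a ≈ b
  add-cancel {a} {b} {c} = cancelʳ c a b

  S-neg : ∀ n (f : ℕ → Carrier) → - S n f ≈ S n (λ k → - f k)
  S-neg zero    f = -0#≈0#
  S-neg (suc n) f = trans (sym (-‿+-comm _ _)) (+-congʳ (S-neg n f))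

  pow-+ : ∀ x a b → pow K x (a ℕ.+ b) ≈ pow K x a * pow K x b
  pow-+ x zero    b = sym (*-identityˡ _)
  pow-+ x (suc a) b = trans (*-congˡ (pow-+ x a b)) (sym (*-assoc _ _ _))

  pow-1# : ∀ n → pow K 1# n ≈ 1#
  pow-1# zero    = refl
  pow-1# (suc n) = trans (*-identityˡ _) (pow-1# n)

  pow-cong : ∀ {x y} n → x ≈ y → pow K x n ≈ pow K y n
  pow-cong zero    e = refl
  pow-cong (suc n) e = *-cong e (pow-cong n e)

  pow-* : ∀ x a b → pow K x (a ℕ.* b) ≈ pow K (pow K x a) b
  pow-* x a zero    = reflexive (P.cong (pow K x) (ℕP.*-zeroʳ a))
  pow-* x a (suc b) = begin
    pow K x (a ℕ.* suc b)              ≡⟨ P.cong (pow K x) (ℕP.*-suc a b) ⟩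
    pow K x (a ℕ.+ a ℕ.* b)            ≈⟨ pow-+ x a (a ℕ.* b) ⟩
    pow K x a * pow K x (a ℕ.* b)      ≈⟨ *-congˡ (pow-* x a b) ⟩
    pow K x a * pow K (pow K x a) b    ∎

  ζ-root′ : ∀ q .{{_ : NonZero q}} → pow K (ζ q) q ≈ 1#
  ζ-root′ (suc q) = ζ-root q

  ζ-prim′ : ∀ q .{{_ : NonZero q}} k → 0 < k → k < q → ¬ (pow K (ζ q) k ≈ 1#)
  ζ-prim′ (suc q) = ζ-prim q

  ζ-compat′ : ∀ d s .{{_ : NonZero d}} .{{_ : NonZero s}} → pow K (ζ (d ℕ.* s)) d ≈ ζ s
  ζ-compat′ (suc d) (suc s) = ζ-compat d s

  e-def : ∀ q .{{_ : NonZero q}} t → e q t ≡ pow K (ζ q) (t ℤ.%ℕ q)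
  e-def (suc q) t = P.refl

  module _ (q : ℕ) .{{_ : NonZero q}} where

    pow-ζ-% : ∀ a → pow K (ζ q) a ≈ pow K (ζ q) (a % q)
    pow-ζ-% a = begin
      pow K (ζ q) a                                   ≡⟨ P.cong (pow K (ζ q)) (P.trans (m≡m%n+[m/n]*n a q) (P.cong (a % q ℕ.+_) (ℕP.*-comm (a / q) q))) ⟩
      pow K (ζ q) (a % q ℕ.+ q ℕ.* (a / q))           ≈⟨ pow-+ (ζ q) (a % q) _ ⟩
      pow K (ζ q) (a % q) * pow K (ζ q) (q ℕ.* (a / q)) ≈⟨ *-congˡ (trans (pow-* (ζ q) q (a / q)) (trans (pow-cong (a / q) (ζ-root′ q)) (pow-1# (a / q)))) ⟩
      pow K (ζ q) (a % q) * 1#                        ≈⟨ *-identityʳ _ ⟩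
      pow K (ζ q) (a % q)                             ∎

    pow-ζ-≋ : ∀ {a b} → + a ≋ + b [ q ] → pow K (ζ q) a ≈ pow K (ζ q) b
    pow-ζ-≋ {a} {b} a≋b = trans (pow-ζ-% a) (trans (reflexive (P.cong (pow K (ζ q)) (≋⇒%ℕ≡ a≋b))) (sym (pow-ζ-% b)))

    e-cong : ∀ {x y} → x ≋ y [ q ] → e q x ≈ e q y
    e-cong {x} {y} x≋y = reflexive (P.trans (e-def q x) (P.trans (P.cong (pow K (ζ q)) (≋⇒%ℕ≡ x≋y)) (P.sym (e-def q y))))

    e-+ : ∀ x y → e q (x ℤ.+ y) ≈ e q x * e q y
    e-+ x y = begin
      e q (x ℤ.+ y)                                      ≡⟨ e-def q (x ℤ.+ y) ⟩
      pow K (ζ q) ((x ℤ.+ y) ℤ.%ℕ q)                      ≈⟨ pow-ζ-≋ (≋-trans (%ℕ-≋ (x ℤ.+ y) q) (≋-sym (≋-+ (%ℕ-≋ x q) (%ℕ-≋ y q)))) ⟩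
      pow K (ζ q) (x ℤ.%ℕ q ℕ.+ y ℤ.%ℕ q)                 ≈⟨ pow-+ (ζ q) (x ℤ.%ℕ q) (y ℤ.%ℕ q) ⟩
      pow K (ζ q) (x ℤ.%ℕ q) * pow K (ζ q) (y ℤ.%ℕ q)     ≡⟨ P.sym (P.cong₂ _*_ (e-def q x) (e-def q y)) ⟩
      e q x * e q y                                      ∎

    e-0 : e q (+ 0) ≈ 1#
    e-0 = trans (reflexive (e-def q (+ 0))) (sym (pow-ζ-% 0))

    e-mul : ∀ a x → e q (+ a ℤ.* x) ≈ pow K (e q x) a
    e-mul zero    x = trans (e-cong (≋-reflexive (ℤP.*-zeroˡ x))) e-0
    e-mul (suc a) x = begin
      e q (+ suc a ℤ.* x)        ≡⟨ P.cong (e q) (unfold (+ a) x) ⟩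
      e q (x ℤ.+ + a ℤ.* x)      ≈⟨ e-+ x (+ a ℤ.* x) ⟩
      e q x * e q (+ a ℤ.* x)    ≈⟨ *-congˡ (e-mul a x) ⟩
      e q x * pow K (e q x) a    ∎
      where
      unfold : ∀ A X → (ℤ.1ℤ ℤ.+ A) ℤ.* X ≡ X ℤ.+ A ℤ.* X
      unfold = solve-∀

    e-pow-q : ∀ x → pow K (e q x) q ≈ 1#
    e-pow-q x = trans (sym (e-mul q x)) (trans (e-cong (≋-mul0ˡ q x)) (trans (e-cong (≋-reflexive (ℤP.*-zeroˡ x))) e-0))

    e-nontrivial : ∀ x → ¬ (q ∣ ∣ x ∣) → ¬ (e q x ≈ 1#)
    e-nontrivial x q∤x e≈1 = ζ-prim′ q (x ℤ.%ℕ q) (ℕP.n≢0⇒n>0 (λ r≡0 → q∤x (%ℕ≡0⇒∣ x q r≡0))) (ℤDM.n%ℕd<d x q)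
      (trans (reflexive (P.sym (e-def q x))) e≈1)

  geometric-sum : ∀ w n → (w - 1#) * S n (pow K w) ≈ pow K w n - 1#
  geometric-sum w zero    = trans (zeroʳ _) (sym (-‿inverseʳ 1#))
  geometric-sum w (suc n) = begin
    (w - 1#) * (S n (pow K w) + pow K w n)             ≈⟨ distribˡ _ _ _ ⟩
    (w - 1#) * S n (pow K w) + (w - 1#) * pow K w n    ≈⟨ +-cong (geometric-sum w n) (trans (distribʳ _ w (- 1#)) (+-congˡ (-1*x≈-x _))) ⟩
    (pow K w n - 1#) + (w * pow K w n - pow K w n)     ≈⟨ telescope (pow K w n) (w * pow K w n) 1# ⟩
    w * pow K w n - 1#                                 ∎
    where
    telescope : ∀ a b c → (a - c) + (b - a) ≈ b - c
    telescope a b c = begin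
      (a - c) + (b - a)   ≈⟨ solve 4 (λ a b nc na → (a :+ nc) :+ (b :+ na) := (b :+ nc) :+ (a :+ na)) refl a b (- c) (- a) ⟩
      (b - c) + (a - a)   ≈⟨ +-congˡ (-‿inverseʳ a) ⟩
      (b - c) + 0#        ≈⟨ +-identityʳ _ ⟩
      b - c               ∎

  root-of-unity-sum : ∀ w n → pow K w n ≈ 1# → ¬ (w ≈ 1#) → S n (pow K w) ≈ 0#
  root-of-unity-sum w n wⁿ≈1 w≉1 = *-cancel-nonzero (λ w-1≈0 → w≉1 (w-1≈0⇒w≈1 w-1≈0))
    (trans (geometric-sum w n) (trans (+-congʳ wⁿ≈1) (trans (-‿inverseʳ 1#) (sym (zeroʳ _)))))
    where
    w-1≈0⇒w≈1 : w - 1# ≈ 0# → w ≈ 1#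
    w-1≈0⇒w≈1 e = add-cancel (trans e (sym (-‿inverseʳ 1#)))

  character-sum : ∀ q .{{_ : NonZero q}} x → ¬ (q ∣ ∣ x ∣) → S q (λ a → e q (+ a ℤ.* x)) ≈ 0#
  character-sum q x q∤x = trans (S-cong′ q (λ a → e-mul q a x)) (root-of-unity-sum (e q x) q (e-pow-q q x) (e-nontrivial q x q∤x))

  -- c_p(x) = −1 for a prime p ∤ x: the complete character sum vanishes and
  -- 0 is the only non-unit residue.
  unit-character-sum : ∀ p .{{_ : NonZero p}} → Prime p → ∀ x → ¬ (p ∣ ∣ x ∣) →
    S p (λ a → ind (unitᵇ p a) * e p (+ a ℤ.* x)) ≈ - 1#
  unit-character-sum p pr x p∤x = begin
    S p (λ a → ind (unitᵇ p a) * X a)   ≈⟨ inverseˡ-unique _ _ (trans without-zero (trans (+-cong (character-sum p x p∤x) zero-not-unit) (+-identityˡ 0#))) ⟩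
    - X 0                               ≈⟨ -‿cong (trans (e-cong p (≋-reflexive (ℤP.*-zeroˡ x))) (e-0 p)) ⟩
    - 1#                                ∎
    where
    X : ℕ → Carrier
    X a = e p (+ a ℤ.* x)
    unit-off-0 : ∀ k → k < p → k ≢ 0 → ind (unitᵇ p k) * X k ≈ X k
    unit-off-0 zero    _   0≢0 = ⊥-elim (0≢0 P.refl)
    unit-off-0 (suc k) k<p _   = trans (*-congʳ (reflexive (P.cong ind (cop⇒unitᵇ (suc k) p (prime-cop-small pr (ℕ.s≤s ℕ.z≤n) k<p)))))
                                       (*-identityˡ _)
    zero-not-unit : ind (unitᵇ p 0) * X 0 ≈ 0#
    zero-not-unit with unitᵇ p 0 in eq
    ... | true  = ⊥-elim (prime-¬cop0 pr (unitᵇ⇒cop 0 p eq))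
    ... | false = zeroˡ _
    without-zero : S p (λ a → ind (unitᵇ p a) * X a) + X 0 ≈ S p X + ind (unitᵇ p 0) * X 0
    without-zero = S-update p 0 _ X (ℕ.>-nonZero⁻¹ p) unit-off-0

  e-compat : ∀ d s .{{_ : NonZero d}} .{{_ : NonZero s}} x → e (d ℕ.* s) (+ d ℤ.* x) ≈ e s x
  e-compat d s x = begin
    e (d ℕ.* s) (+ d ℤ.* x)                  ≡⟨ e-def (d ℕ.* s) _ ⟩
    pow K (ζ (d ℕ.* s)) ((+ d ℤ.* x) ℤ.%ℕ (d ℕ.* s)) ≈⟨ pow-ζ-≋ (d ℕ.* s) residues ⟩
    pow K (ζ (d ℕ.* s)) (d ℕ.* (x ℤ.%ℕ s))    ≈⟨ pow-* (ζ (d ℕ.* s)) d (x ℤ.%ℕ s) ⟩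
    pow K (pow K (ζ (d ℕ.* s)) d) (x ℤ.%ℕ s)  ≈⟨ pow-cong (x ℤ.%ℕ s) (ζ-compat′ d s) ⟩
    pow K (ζ s) (x ℤ.%ℕ s)                   ≡⟨ P.sym (e-def s x) ⟩
    e s x                                    ∎
    where
    instance
      ds≢0 : NonZero (d ℕ.* s)
      ds≢0 = ℕP.m*n≢0 d s
    residues : + ((+ d ℤ.* x) ℤ.%ℕ (d ℕ.* s)) ≋ + (d ℕ.* (x ℤ.%ℕ s)) [ d ℕ.* s ]
    residues = ≋-trans (%ℕ-≋ (+ d ℤ.* x) (d ℕ.* s))
      (≋-trans (≋-scale d (≋-sym (%ℕ-≋ x s))) (≋-reflexive (P.sym (ℤP.pos-* d (x ℤ.%ℕ s)))))

  -- A d-periodic weight W against a ↦ e_{d·s}(−r·a) sums to zero over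
  -- [0, d·s) when s ∤ r: writing a = k·d + i, the sum over k is a
  -- character sum modulo s.
  periodic-orthogonality : ∀ d s .{{_ : NonZero d}} .{{_ : NonZero s}} r (W : ℕ → Carrier) → ¬ (s ∣ r) →
    (∀ k i → i < d → W (k ℕ.* d ℕ.+ i) ≈ W i) →
    S (d ℕ.* s) (λ a → W a * e (d ℕ.* s) (ℤ.- (+ r ℤ.* + a))) ≈ 0#
  periodic-orthogonality d s r W s∤r periodic = begin
    S (d ℕ.* s) f                                       ≡⟨ P.cong (λ t → S t f) (ℕP.*-comm d s) ⟩
    S (s ℕ.* d) f                                       ≈⟨ S-block s d f ⟩
    S s (λ k → S d (λ i → f (k ℕ.* d ℕ.+ i)))            ≈⟨ S-cong′ s (λ k → S-cong d (λ i i<d → block-term k i i<d)) ⟩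
    S s (λ k → S d (λ i → g i * e s (+ k ℤ.* ℤ.- + r)))  ≈⟨ S-swap s d _ ⟩
    S d (λ i → S s (λ k → g i * e s (+ k ℤ.* ℤ.- + r)))  ≈⟨ S-cong′ d (λ i → sym (S-*ˡ s (g i) _)) ⟩
    S d (λ i → g i * S s (λ k → e s (+ k ℤ.* ℤ.- + r)))  ≈⟨ S-0 d (λ i _ → trans (*-congˡ (character-sum s (ℤ.- + r) s∤-r)) (zeroʳ _)) ⟩
    0#                                                  ∎
    where
    instance
      ds≢0 : NonZero (d ℕ.* s)
      ds≢0 = ℕP.m*n≢0 d s
    f : ℕ → Carrier
    f a = W a * e (d ℕ.* s) (ℤ.- (+ r ℤ.* + a))
    g : ℕ → Carrier
    g i = W i * e (d ℕ.* s) (ℤ.- (+ r ℤ.* + i))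
    s∤-r : ¬ (s ∣ ∣ ℤ.- + r ∣)
    s∤-r s∣ = s∤r (P.subst (s ∣_) (ℤP.∣-i∣≡∣i∣ (+ r)) s∣)
    split : ∀ R K D I → ℤ.- (R ℤ.* (K ℤ.* D ℤ.+ I)) ≡ ℤ.- (R ℤ.* I) ℤ.+ D ℤ.* (K ℤ.* ℤ.- R)
    split = solve-∀
    block-term : ∀ k i → i < d → f (k ℕ.* d ℕ.+ i) ≈ g i * e s (+ k ℤ.* ℤ.- + r)
    block-term k i i<d = begin
      W (k ℕ.* d ℕ.+ i) * e (d ℕ.* s) (ℤ.- (+ r ℤ.* + (k ℕ.* d ℕ.+ i)))          ≈⟨ *-cong (periodic k i i<d) (reflexive (P.cong (e (d ℕ.* s)) exponent)) ⟩
      W i * e (d ℕ.* s) (ℤ.- (+ r ℤ.* + i) ℤ.+ + d ℤ.* (+ k ℤ.* ℤ.- + r))         ≈⟨ *-congˡ (e-+ (d ℕ.* s) _ _) ⟩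
      W i * (e (d ℕ.* s) (ℤ.- (+ r ℤ.* + i)) * e (d ℕ.* s) (+ d ℤ.* (+ k ℤ.* ℤ.- + r))) ≈⟨ *-congˡ (*-congˡ (e-compat d s _)) ⟩
      W i * (e (d ℕ.* s) (ℤ.- (+ r ℤ.* + i)) * e s (+ k ℤ.* ℤ.- + r))           ≈⟨ sym (*-assoc _ _ _) ⟩
      g i * e s (+ k ℤ.* ℤ.- + r)                                              ∎
      where
      exponent : ℤ.- (+ r ℤ.* + (k ℕ.* d ℕ.+ i)) ≡ ℤ.- (+ r ℤ.* + i) ℤ.+ + d ℤ.* (+ k ℤ.* ℤ.- + r)
      exponent = P.trans (P.cong (λ t → ℤ.- (+ r ℤ.* t)) (P.trans (ℤP.pos-+ (k ℕ.* d) i) (P.cong (ℤ._+ + i) (ℤP.pos-* k d))))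
                         (split (+ r) (+ k) (+ d) (+ i))

  Σ0≈S : ∀ n (f : ℤ → Carrier) → Σ0 n f ≈ S n (λ k → f (+ k))
  Σ0≈S zero    f = refl
  Σ0≈S (suc n) f = +-congʳ (Σ0≈S n f)

  Σ1≈S : ∀ n (f : ℕ → Carrier) → Σ1 n f ≈ S n (λ k → f (suc k))
  Σ1≈S zero    f = refl
  Σ1≈S (suc n) f = +-congʳ (Σ1≈S n f)

  Σunits≈S : ∀ q (g : ℕ → Carrier) → g q ≈ g 0 → Σunits q g ≈ S q (λ r → ind (unitᵇ q r) * g r)
  Σunits≈S q g g-periodic = begin
    Σunits q g                             ≈⟨ Σ1≈S q G ⟩
    S q (λ k → G (suc k))                  ≈⟨ add-cancel (trans (S-rotate q G) (+-congˡ G-periodic)) ⟩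
    S q G                                  ≈⟨ S-cong′ q G≈ind ⟩
    S q (λ r → ind (unitᵇ q r) * g r)      ∎
    where
    G : ℕ → Carrier
    G r = if unitᵇ q r then g r else 0#
    G-periodic : G q ≈ G 0
    G-periodic rewrite gcd-idem q | gcd-identityˡ q with q ℕ.≡ᵇ 1
    ... | true  = g-periodic
    ... | false = refl
    G≈ind : ∀ r → G r ≈ ind (unitᵇ q r) * g r
    G≈ind r with unitᵇ q r
    ... | true  = sym (*-identityˡ _)
    ... | false = sym (zeroˡ _)


module Lemma5p12 {c ℓ : Level} (F : CycloField c ℓ) (N q' : ℕ) (a' : ℤ)
                 (q'>0 : 0 < q') (a'⊥q' : gcd ∣ a' ∣ q' ≡ 1) where

  open CF F
  open Fixed N q' a'
  open FiniteSums commutativeSemiring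
  open Cyclotomic F
  open Arithmetic
  open import Data.Nat as ℕ using (ℕ; zero; suc; _<_; NonZero)
  import Data.Nat.Properties as ℕP
  open import Data.Nat.Divisibility as Div using (_∣_; _∣?_; quotient; m∣n⇒n≡quotient*m)
  open import Data.Nat.DivMod using (_%_; n/n≡1)
  open import Data.Nat.GCD using (gcd[m,n]∣m; gcd-greatest)
  open import Data.Nat.LCM using (lcm; gcd*lcm)
  open import Data.Nat.Coprimality as Cop using (Coprime)
  open import Data.Nat.Primality using (Prime)
  open import Data.Integer as ℤ using (ℤ; +_; ∣_∣)
  import Data.Integer.Properties as ℤP
  import Data.Integer.DivMod as ℤDM
  import Data.Integer.Divisibility.Signed as ZD
  open import Data.Integer.Tactic.RingSolver using (solve-∀)
  open import Data.Bool using (Bool; true; false; if_then_else_)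
  open import Data.Product using (_,_; proj₁; proj₂)
  open import Data.Empty using (⊥-elim)
  open import Relation.Nullary using (¬_; yes; no)
  open import Relation.Nullary.Decidable using (⌊_⌋)
  open import Relation.Binary.PropositionalEquality as P using (_≡_; _≢_)
  open import Relation.Binary.Reasoning.Setoid setoid
  open import Algebra.Solver.Ring.NaturalCoefficients.Default commutativeSemiring
  open import Algebra.Properties.CommutativeSemigroup *-commutativeSemigroup using (interchange; x∙yz≈y∙xz; xy∙z≈xz∙y)
  open import Algebra.Properties.Ring ring using (-‿distribˡ-*; -‿distribʳ-*)

  congᵇ : ℕ → ℕ → Bool
  congᵇ q a = ⌊ gcd q q' ∣? ∣ + a ℤ.- a' ∣ ⌋

  scale : ℕ → Carrier
  scale q = ι q /ι φ (lcm q q')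

  κ : ℕ → Carrier
  κ q = ι (φ q') * scale q

  w : ℕ → ℕ → Carrier
  w q a = ind (unitᵇ q a) * ind (congᵇ q a)

  ρ-factor : ∀ q a → ρ q (+ a) ≈ scale q * w q a
  ρ-factor q a with unitᵇ q a | congᵇ q a
  ... | true  | true  = sym (trans (*-congˡ (*-identityˡ 1#)) (*-identityʳ _))
  ... | true  | false = sym (trans (*-congˡ (zeroʳ 1#)) (zeroʳ _))
  ... | false | _     = sym (trans (*-congˡ (zeroˡ _)) (zeroʳ _))

  congᵇ-periodic : ∀ q d k i → gcd q q' ∣ d → congᵇ q (k ℕ.* d ℕ.+ i) ≡ congᵇ q i
  congᵇ-periodic q d k i g∣d = dec-ext _ _ (∣-≋ shift) (∣-≋ (≋-sym shift))
    where
    shift : + (k ℕ.* d ℕ.+ i) ℤ.- a' ≋ + i ℤ.- a' [ gcd q q' ]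
    shift = ≋-div g∣d (≋-+ (≋-addmulˡ i k d) (≋-refl {ℤ.- a'}))

  ρ-periodic : ∀ d k i → ρ d (+ (k ℕ.* d ℕ.+ i)) ≈ ρ d (+ i)
  ρ-periodic d k i = trans (ρ-factor d _) (trans (reflexive (P.cong₂ (λ u v → scale d * (ind u * ind v))
    (unitᵇ-periodic d k i) (congᵇ-periodic d d k i (gcd[m,n]∣m d q')))) (sym (ρ-factor d i)))

  -- For a proper divisor d of q and a unit r mod q, ρ_d is orthogonal to
  -- a ↦ e_q(−r·a): ρ_d is d-periodic and q/d ∤ r.
  proper-divisor-vanishes : ∀ q d .{{_ : NonZero q}} .{{_ : NonZero d}} r → d ∣ q → d ≢ q → Coprime r q →
    S q (λ a → ρ d (+ a) * e q (ℤ.- (+ r ℤ.* + a))) ≈ 0#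
  proper-divisor-vanishes q d r d∣q d≢q r⊥q with quotient d∣q | m∣n⇒n≡quotient*m d∣q
  ... | zero  | q≡0 = ⊥-elim (ℕP.<-irrefl (P.sym q≡0) (ℕ.>-nonZero⁻¹ q))
  ... | s@(suc _) | q≡s*d = P.subst (λ Q → S Q (λ a → ρ d (+ a) * e Q (ℤ.- (+ r ℤ.* + a))) ≈ 0#)
      (P.trans (ℕP.*-comm d s) (P.sym q≡s*d))
      (periodic-orthogonality d s r (λ a → ρ d (+ a)) s∤r (λ k i _ → ρ-periodic d k i))
    where
    s∤r : ¬ (s ∣ r)
    s∤r s∣r = d≢q (P.sym (P.trans q≡s*d (P.trans (P.cong (ℕ._* d) s≡1) (ℕP.*-identityˡ d))))
      where
      s≡1 : s ≡ 1
      s≡1 = r⊥q (s∣r , P.subst (s ∣_) (P.sym q≡s*d) (Div.m∣m*n d))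

  -- Möbius inversion collapses on units: for gcd(r, q) = 1 only the top
  -- divisor d = q of ρ*_q survives in h_q(r), with μ(1) = 1.
  h-reduction : ∀ q .{{_ : NonZero q}} r → Coprime r q →
    h q r ≈ S q (λ a → ι (φ q') * ρ q (+ a) * e q (ℤ.- (+ r ℤ.* + a)))
  h-reduction q@(suc q₀) r r⊥q = begin
    h q r                                        ≈⟨ Σ0≈S q _ ⟩
    S q (λ a → φ' * ρ* q (+ a) * E a)            ≈⟨ S-cong′ q (λ a → *-congʳ (*-congˡ (Σ1≈S q _))) ⟩
    S q (λ a → φ' * S q (λ d → T d a) * E a)     ≈⟨ S-cong′ q (λ a → trans (*-congʳ (S-*ˡ q φ' _)) (S-*ʳ q (E a) _)) ⟩
    S q (λ a → S q (λ d → φ' * T d a * E a))     ≈⟨ S-swap q q _ ⟩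
    S q (λ d → S q (λ a → φ' * T d a * E a))     ≈⟨ S-single q q₀ _ ℕP.≤-refl other-divisors ⟩
    S q (λ a → φ' * T q₀ a * E a)                ≈⟨ S-cong′ q top-divisor ⟩
    S q (λ a → φ' * ρ q (+ a) * E a)             ∎
    where
    φ' = ι (φ q')
    E : ℕ → Carrier
    E a = e q (ℤ.- (+ r ℤ.* + a))
    -- the summand of ρ*_q(a) for the candidate divisor 1 + d
    T : ℕ → ℕ → Carrier
    T d a = if ⌊ suc d ∣? q ⌋ then ιz (μ (quot q (suc d))) * ρ (suc d) (+ a) else 0#
    μ[q/q]≈1 : ιz (μ (quot q q)) ≈ 1#
    μ[q/q]≈1 = trans (reflexive (P.cong (λ t → ιz (μ t)) (n/n≡1 q))) ι-1
    top-divisor : ∀ a → φ' * T q₀ a * E a ≈ φ' * ρ q (+ a) * E a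
    top-divisor a with q ∣? q
    ... | no q∤q = ⊥-elim (q∤q Div.∣-refl)
    ... | yes _  = *-congʳ (*-congˡ (trans (*-congʳ μ[q/q]≈1) (*-identityˡ _)))
    other-divisors : ∀ d → d < q → d ≢ q₀ → S q (λ a → φ' * T d a * E a) ≈ 0#
    other-divisors d d<q d≢q₀ with suc d ∣? q
    ... | no _    = S-0 q (λ a _ → trans (*-congʳ (zeroʳ φ')) (zeroˡ _))
    ... | yes d∣q = begin
      S q (λ a → φ' * (μd * ρ (suc d) (+ a)) * E a)    ≈⟨ S-cong′ q (λ a → solve 4 (λ f m p x → f :* (m :* p) :* x := (f :* m) :* (p :* x)) refl φ' μd _ _) ⟩
      S q (λ a → (φ' * μd) * (ρ (suc d) (+ a) * E a))  ≈⟨ sym (S-*ˡ q _ _) ⟩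
      (φ' * μd) * S q (λ a → ρ (suc d) (+ a) * E a)    ≈⟨ *-congˡ (proper-divisor-vanishes q (suc d) r d∣q (λ e → d≢q₀ (ℕP.suc-injective e)) r⊥q) ⟩
      (φ' * μd) * 0#                                   ≈⟨ zeroʳ _ ⟩
      0#                                               ∎
      where
      μd = ιz (μ (quot q (suc d)))

  D-term : ℕ → ℕ → Carrier
  D-term q r = ind (unitᵇ q r) * S q (λ a → w q a * e q (+ r ℤ.* (+ N ℤ.- + a)))

  D : ℕ → Carrier
  D q = S q (D-term q)

  on-units : ∀ q r {x y} → (Coprime r q → x ≈ y) → ind (unitᵇ q r) * x ≈ ind (unitᵇ q r) * y
  on-units q r {x} {y} x≈y with unitᵇ q r in eq
  ... | true  = *-congˡ (x≈y (unitᵇ⇒cop r q eq))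
  ... | false = trans (zeroˡ x) (sym (zeroˡ y))

  b-factor : ∀ q .{{_ : NonZero q}} → b q ≈ κ q * D q
  b-factor q = begin
    b q                                                     ≈⟨ Σunits≈S q g g-periodic ⟩
    S q (λ r → ind (unitᵇ q r) * g r)                       ≈⟨ S-cong′ q (λ r → on-units q r (λ r⊥q → unit-term r r⊥q)) ⟩
    S q (λ r → ind (unitᵇ q r) * (κ q * inner r))           ≈⟨ S-cong′ q (λ r → x∙yz≈y∙xz _ _ _) ⟩
    S q (λ r → κ q * (ind (unitᵇ q r) * inner r))           ≈⟨ sym (S-*ˡ q _ _) ⟩
    κ q * D q                                               ∎
    where
    g : ℕ → Carrier
    g r = e q (+ r ℤ.* + N) * h q r
    g-periodic : g q ≈ g 0
    g-periodic = *-cong (e-cong q (≋-mul0ˡ q (+ N)))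
      (trans (Σ0≈S q _) (trans (S-cong′ q (λ a → *-congˡ (e-cong q (≋-neg (≋-mul0ˡ q (+ a)))))) (sym (Σ0≈S q _))))
    inner : ℕ → Carrier
    inner r = S q (λ a → w q a * e q (+ r ℤ.* (+ N ℤ.- + a)))
    combine : ∀ R N A → R ℤ.* N ℤ.+ ℤ.- (R ℤ.* A) ≡ R ℤ.* (N ℤ.- A)
    combine = solve-∀
    term : ∀ r a → e q (+ r ℤ.* + N) * (ι (φ q') * ρ q (+ a) * e q (ℤ.- (+ r ℤ.* + a)))
                 ≈ κ q * (w q a * e q (+ r ℤ.* (+ N ℤ.- + a)))
    term r a = begin
      e q (+ r ℤ.* + N) * (ι (φ q') * ρ q (+ a) * e q (ℤ.- (+ r ℤ.* + a)))             ≈⟨ *-congˡ (*-congʳ (*-congˡ (ρ-factor q a))) ⟩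
      e q (+ r ℤ.* + N) * (ι (φ q') * (scale q * w q a) * e q (ℤ.- (+ r ℤ.* + a)))     ≈⟨ solve 5 (λ x f c i y → x :* (f :* (c :* i) :* y) := (f :* c) :* (i :* (x :* y))) refl _ _ _ _ _ ⟩
      κ q * (w q a * (e q (+ r ℤ.* + N) * e q (ℤ.- (+ r ℤ.* + a))))                     ≈⟨ *-congˡ (*-congˡ (trans (sym (e-+ q _ _)) (reflexive (P.cong (e q) (combine (+ r) (+ N) (+ a)))))) ⟩
      κ q * (w q a * e q (+ r ℤ.* (+ N ℤ.- + a)))                                       ∎
    unit-term : ∀ r → Coprime r q → g r ≈ κ q * inner r
    unit-term r r⊥q = begin
      e q (+ r ℤ.* + N) * h q r                                                            ≈⟨ *-congˡ (h-reduction q r r⊥q) ⟩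
      e q (+ r ℤ.* + N) * S q (λ a → ι (φ q') * ρ q (+ a) * e q (ℤ.- (+ r ℤ.* + a)))       ≈⟨ S-*ˡ q _ _ ⟩
      S q (λ a → e q (+ r ℤ.* + N) * (ι (φ q') * ρ q (+ a) * e q (ℤ.- (+ r ℤ.* + a))))     ≈⟨ S-cong′ q (term r) ⟩
      S q (λ a → κ q * (w q a * e q (+ r ℤ.* (+ N ℤ.- + a))))                               ≈⟨ sym (S-*ˡ q _ _) ⟩
      κ q * inner r                                                                        ∎

  ind-congᵇ-mult : ∀ m n a .{{_ : NonZero m}} .{{_ : NonZero n}} → Coprime m n →
    ind (congᵇ (m ℕ.* n) a) ≈ ind (congᵇ m (a % m)) * ind (congᵇ n (a % n))
  ind-congᵇ-mult m n a m⊥n = ind-∧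
    (λ ev → let gmn∣x = P.subst (_∣ ∣ x ∣) (gcd-mult q' m⊥n) (dec-true (gcd (m ℕ.* n) q' ∣? ∣ x ∣) ev) in
        true-dec (gcd m q' ∣? _) (∣-≋ x≋m (Div.m*n∣⇒m∣ (gcd m q') (gcd n q') gmn∣x))
      , true-dec (gcd n q' ∣? _) (∣-≋ x≋n (Div.m*n∣⇒n∣ (gcd m q') (gcd n q') gmn∣x)))
    (λ em en → true-dec (gcd (m ℕ.* n) q' ∣? ∣ x ∣) (P.subst (_∣ ∣ x ∣) (P.sym (gcd-mult q' m⊥n))
        (cop-*-∣ (gcd-cop q' m⊥n) (∣-≋ (≋-sym x≋m) (dec-true (gcd m q' ∣? _) em))
                                  (∣-≋ (≋-sym x≋n) (dec-true (gcd n q' ∣? _) en)))))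
    where
    x = + a ℤ.- a'
    x≋m : x ≋ + (a % m) ℤ.- a' [ gcd m q' ]
    x≋m = ≋-div (gcd[m,n]∣m m q') (≋-+ (≋-sym (%-≋ a m)) (≋-refl {ℤ.- a'}))
    x≋n : x ≋ + (a % n) ℤ.- a' [ gcd n q' ]
    x≋n = ≋-div (gcd[m,n]∣m n q') (≋-+ (≋-sym (%-≋ a n)) (≋-refl {ℤ.- a'}))

  w-mult : ∀ m n a .{{_ : NonZero m}} .{{_ : NonZero n}} → Coprime m n →
    w (m ℕ.* n) a ≈ w m (a % m) * w n (a % n)
  w-mult m n a m⊥n = trans (*-cong (ind-unitᵇ-mult m n a) (ind-congᵇ-mult m n a m⊥n))
    (interchange _ _ _ _)

  e-crt : ∀ m n .{{_ : NonZero m}} .{{_ : NonZero n}} i j (y : ℤ) →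
    e (m ℕ.* n) (+ (i ℕ.* n ℕ.+ j ℕ.* m) ℤ.* y) ≈ e m (+ i ℤ.* y) * e n (+ j ℤ.* y)
  e-crt m n i j y = begin
    e (m ℕ.* n) (+ (i ℕ.* n ℕ.+ j ℕ.* m) ℤ.* y)                        ≡⟨ P.cong (e (m ℕ.* n)) exponent ⟩
    e (m ℕ.* n) (+ n ℤ.* (+ i ℤ.* y) ℤ.+ + m ℤ.* (+ j ℤ.* y))          ≈⟨ e-+ (m ℕ.* n) {{ℕP.m*n≢0 m n}} _ _ ⟩
    e (m ℕ.* n) (+ n ℤ.* (+ i ℤ.* y)) * e (m ℕ.* n) (+ m ℤ.* (+ j ℤ.* y)) ≈⟨ *-cong (trans (reflexive (P.cong (λ t → e t (+ n ℤ.* (+ i ℤ.* y))) (ℕP.*-comm m n))) (e-compat n m _))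
                                                                                     (e-compat m n _) ⟩
    e m (+ i ℤ.* y) * e n (+ j ℤ.* y)                                  ∎
    where
    distribute : ∀ I J Nn Mm Y → (I ℤ.* Nn ℤ.+ J ℤ.* Mm) ℤ.* Y ≡ Nn ℤ.* (I ℤ.* Y) ℤ.+ Mm ℤ.* (J ℤ.* Y)
    distribute = solve-∀
    exponent : + (i ℕ.* n ℕ.+ j ℕ.* m) ℤ.* y ≡ + n ℤ.* (+ i ℤ.* y) ℤ.+ + m ℤ.* (+ j ℤ.* y)
    exponent = P.trans (P.cong (ℤ._* y) (P.trans (ℤP.pos-+ (i ℕ.* n) (j ℕ.* m)) (P.cong₂ ℤ._+_ (ℤP.pos-* i n) (ℤP.pos-* j m))))
                       (distribute (+ i) (+ j) (+ n) (+ m) y)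

  D-term-periodic : ∀ q .{{_ : NonZero q}} x → D-term q (x % q) ≈ D-term q x
  D-term-periodic q x = *-cong (reflexive (P.cong ind (unitᵇ-ext (cop-≋ (%-≋ x q)) (cop-≋ (≋-sym (%-≋ x q))))))
    (S-cong′ q (λ a → *-congˡ (e-cong q (≋-* (%-≋ x q) ≋-refl))))

  D-term-crt : ∀ m n .{{_ : NonZero m}} .{{_ : NonZero n}} → Coprime m n → ∀ i j →
    D-term (m ℕ.* n) (i ℕ.* n ℕ.+ j ℕ.* m) ≈ D-term m i * D-term n j
  D-term-crt m n m⊥n i j = begin
    ind (unitᵇ M X) * S M (λ a → w M a * e M (+ X ℤ.* y a))   ≈⟨ *-cong unit-split (S-crt-product m n {{_}} {{_}} {{ℕP.m*n≢0 m n}} m⊥n _ G H factors) ⟩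
    (ind (unitᵇ m i) * ind (unitᵇ n j)) * (S m G * S n H)     ≈⟨ interchange _ _ _ _ ⟩
    D-term m i * D-term n j                                   ∎
    where
    M = m ℕ.* n
    X = i ℕ.* n ℕ.+ j ℕ.* m
    y : ℕ → ℤ
    y a = + N ℤ.- + a
    G : ℕ → Carrier
    G a = w m a * e m (+ i ℤ.* y a)
    H : ℕ → Carrier
    H a = w n a * e n (+ j ℤ.* y a)
    unit-split : ind (unitᵇ M X) ≈ ind (unitᵇ m i) * ind (unitᵇ n j)
    unit-split = ind-∧
      (λ ev → let X⊥M = unitᵇ⇒cop X M ev in
          cop⇒unitᵇ i m (proj₁ (cop-lin-m {i} {j} {n} {m} (Cop.sym m⊥n)) (cop-divʳ (Div.m∣m*n n) X⊥M))
        , cop⇒unitᵇ j n (proj₁ (cop-lin-n {i} {j} {n} {m} m⊥n) (cop-divʳ (Div.n∣m*n m) X⊥M)))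
      (λ em en → cop⇒unitᵇ X M (cop-*ʳ (proj₂ (cop-lin-m {i} {j} {n} {m} (Cop.sym m⊥n)) (unitᵇ⇒cop i m em))
                                        (proj₂ (cop-lin-n {i} {j} {n} {m} m⊥n) (unitᵇ⇒cop j n en))))
    reduce : ∀ k d .{{_ : NonZero d}} a → e d (+ k ℤ.* y a) ≈ e d (+ k ℤ.* y (a % d))
    reduce k d a = e-cong d (≋-* (≋-refl {+ k}) (≋-+ (≋-refl {+ N}) (≋-neg (≋-sym (%-≋ a d)))))
    factors : ∀ a → a < M → w M a * e M (+ X ℤ.* y a) ≈ G (a % m) * H (a % n)
    factors a _ = begin
      w M a * e M (+ X ℤ.* y a)                                          ≈⟨ *-cong (w-mult m n a m⊥n) (e-crt m n i j (y a)) ⟩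
      (w m (a % m) * w n (a % n)) * (e m (+ i ℤ.* y a) * e n (+ j ℤ.* y a)) ≈⟨ *-congˡ (*-cong (reduce i m a) (reduce j n a)) ⟩
      (w m (a % m) * w n (a % n)) * (e m (+ i ℤ.* y (a % m)) * e n (+ j ℤ.* y (a % n))) ≈⟨ interchange _ _ _ _ ⟩
      G (a % m) * H (a % n)                                              ∎

  -- D is multiplicative: reindex [0, m·n) by CRT and split each term.
  D-mult : ∀ m n .{{_ : NonZero m}} .{{_ : NonZero n}} → Coprime m n → D (m ℕ.* n) ≈ D m * D n
  D-mult m n m⊥n = begin
    S (m ℕ.* n) (D-term (m ℕ.* n))                                        ≈⟨ S-crt m n m⊥n _ ⟩
    S m (λ i → S n (λ j → D-term (m ℕ.* n) ((i ℕ.* n ℕ.+ j ℕ.* m) % (m ℕ.* n)))) ≈⟨ S-cong′ m (λ i → S-cong′ n (λ j →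
                                                                                trans (D-term-periodic (m ℕ.* n) _) (D-term-crt m n m⊥n i j))) ⟩
    S m (λ i → S n (λ j → D-term m i * D-term n j))                        ≈⟨ sym (S-product m n _ _) ⟩
    D m * D n                                                              ∎
    where
    instance
      mn≢0 : NonZero (m ℕ.* n)
      mn≢0 = ℕP.m*n≢0 m n

  instance
    φq'≢0 : NonZero (φ q')
    φq'≢0 = ℕ.>-nonZero (Totient.φ-pos q' q'>0)

  φ-lcm-nonzero : ∀ x → 0 < x → NonZero (φ (lcm x q'))
  φ-lcm-nonzero x x>0 = ℕ.>-nonZero (Totient.φ-pos _ (P.subst (0 <_) (P.sym lcm≡)
    (ℕP.*-mono-< {0} {q'} {0} q'>0 (Totient.cofactor-pos x q' x>0))))
    where
    lcm≡ : lcm x q' ≡ q' ℕ.* Totient.cofactor x q'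
    lcm≡ = lcm-form x q' _ (gcd-pos x q' q'>0) (Totient.cofactor-spec x q')

  -- κ is multiplicative on coprime arguments, by the totient identity φ-lcm-mult.
  κ-mult : ∀ m n → 0 < m → 0 < n → Coprime m n → κ (m ℕ.* n) ≈ κ m * κ n
  κ-mult m n m>0 n>0 m⊥n = begin
    φ' * (ι (m ℕ.* n) * recip (φ Lmn))                ≈⟨ *-congˡ (*-cong (ι-* m n) recip-Lmn) ⟩
    φ' * ((ι m * ι n) * (φ' * (recip (φ Lm) * recip (φ Ln)))) ≈⟨ solve 6 (λ f a b g d e → f :* ((a :* b) :* (g :* (d :* e))) := (f :* (a :* d)) :* (g :* (b :* e))) refl φ' (ι m) (ι n) φ' _ _ ⟩
    κ m * κ n                                        ∎
    where
    φ' = ι (φ q')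
    Lm = lcm m q'
    Ln = lcm n q'
    Lmn = lcm (m ℕ.* n) q'
    instance
      φLm≢0 = φ-lcm-nonzero m m>0
      φLn≢0 = φ-lcm-nonzero n n>0
      φLmn≢0 = φ-lcm-nonzero (m ℕ.* n) (ℕP.*-mono-< {0} {m} {0} m>0 n>0)
    ι-identity : ι (φ Lmn) * φ' ≈ ι (φ Lm) * ι (φ Ln)
    ι-identity = trans (sym (ι-* (φ Lmn) (φ q')))
      (trans (reflexive (P.cong ι (Totient.φ-lcm-mult m n q' m>0 n>0 q'>0 m⊥n))) (ι-* (φ Lm) (φ Ln)))
    recip-Lmn : recip (φ Lmn) ≈ φ' * (recip (φ Lm) * recip (φ Ln))
    recip-Lmn = recip-unique (φ Lmn) (begin
      ι (φ Lmn) * (φ' * (recip (φ Lm) * recip (φ Ln)))                   ≈⟨ sym (*-assoc _ _ _) ⟩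
      (ι (φ Lmn) * φ') * (recip (φ Lm) * recip (φ Ln))                   ≈⟨ *-congʳ ι-identity ⟩
      (ι (φ Lm) * ι (φ Ln)) * (recip (φ Lm) * recip (φ Ln))              ≈⟨ interchange _ _ _ _ ⟩
      (ι (φ Lm) * recip (φ Lm)) * (ι (φ Ln) * recip (φ Ln))              ≈⟨ *-cong (recip-inverse (φ Lm)) (recip-inverse (φ Ln)) ⟩
      1# * 1#                                                            ≈⟨ *-identityˡ 1# ⟩
      1#                                                                 ∎)

  b-mult : ∀ m n → 0 < m → 0 < n → Coprime m n → b (m ℕ.* n) ≈ b m * b n
  b-mult m n m>0 n>0 m⊥n = begin
    b (m ℕ.* n)                   ≈⟨ b-factor (m ℕ.* n) ⟩
    κ (m ℕ.* n) * D (m ℕ.* n)     ≈⟨ *-cong (κ-mult m n m>0 n>0 m⊥n) (D-mult m n m⊥n) ⟩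
    (κ m * κ n) * (D m * D n)     ≈⟨ interchange _ _ _ _ ⟩
    (κ m * D m) * (κ n * D n)     ≈⟨ sym (*-cong (b-factor m) (b-factor n)) ⟩
    b m * b n                     ∎
    where
    instance
      m≢0 = ℕ.>-nonZero m>0
      n≢0 = ℕ.>-nonZero n>0
      mn≢0 : NonZero (m ℕ.* n)
      mn≢0 = ℕP.m*n≢0 m n

  cR-as-S : ∀ q .{{_ : NonZero q}} x → cR q x ≈ S q (λ r → ind (unitᵇ q r) * e q (+ r ℤ.* x))
  cR-as-S q x = Σunits≈S q _ (e-cong q (≋-mul0ˡ q x))

  -- Case q ∣ q'.  Then lcm(q, q') = q' and gcd(q, q') = q, so κ(q) = q and
  -- the weight w_q is supported on the single residue a ≡ a' (mod q).
  κ-divisor : ∀ q → q ∣ q' → κ q ≈ ι q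
  κ-divisor q q∣q' = begin
    ι (φ q') * (ι q * recip (φ (lcm q q')))  ≡⟨ P.cong (λ t → ι (φ q') * (ι q * recip (φ t))) (lcm-of-divisor q∣q') ⟩
    ι (φ q') * (ι q * recip (φ q'))          ≈⟨ x∙yz≈y∙xz _ _ _ ⟩
    ι q * (ι (φ q') * recip (φ q'))          ≈⟨ *-congˡ (recip-inverse (φ q')) ⟩
    ι q * 1#                                 ≈⟨ *-identityʳ _ ⟩
    ι q                                      ∎

  w-divisor : ∀ q .{{_ : NonZero q}} → q ∣ q' → ∀ r →
    S q (λ a → w q a * e q (+ r ℤ.* (+ N ℤ.- + a))) ≈ e q (+ r ℤ.* (+ N ℤ.- a'))
  w-divisor q q∣q' r = trans (S-single q a₀ _ a₀<q off-a₀) at-a₀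
    where
    a₀ = a' ℤ.%ℕ q
    a₀<q : a₀ < q
    a₀<q = ℤDM.n%ℕd<d a' q
    a₀≋a' : + a₀ ≋ a' [ q ]
    a₀≋a' = %ℕ-≋ a' q
    gcd≡q : gcd q q' ≡ q
    gcd≡q = gcd-of-divisor q∣q'
    congᵇ⇒a₀ : ∀ a → a < q → congᵇ q a ≡ true → a ≡ a₀
    congᵇ⇒a₀ a a<q ev = ≋-small a<q a₀<q (≋-trans (cg (ZD.∣ᵤ⇒∣ (P.subst (_∣ ∣ + a ℤ.- a' ∣) gcd≡q (dec-true _ ev)))) (≋-sym a₀≋a'))
    congᵇ-a₀ : congᵇ q a₀ ≡ true
    congᵇ-a₀ = true-dec _ (P.subst (_∣ ∣ + a₀ ℤ.- a' ∣) (P.sym gcd≡q) (ZD.∣⇒∣ᵤ (un a₀≋a')))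
    -- a₀ is a unit mod q since gcd(a', q') = 1 and q ∣ q'
    unitᵇ-a₀ : unitᵇ q a₀ ≡ true
    unitᵇ-a₀ = cop⇒unitᵇ a₀ q λ {d} (d∣a₀ , d∣q) → Div.∣1⇒≡1 (P.subst (d ∣_) a'⊥q'
      (gcd-greatest (∣-≋ (≋-div d∣q a₀≋a') d∣a₀) (Div.∣-trans d∣q q∣q')))
    off-a₀ : ∀ k → k < q → k ≢ a₀ → w q k * e q (+ r ℤ.* (+ N ℤ.- + k)) ≈ 0#
    off-a₀ k k<q k≢a₀ with congᵇ q k in eq
    ... | true  = ⊥-elim (k≢a₀ (congᵇ⇒a₀ k k<q eq))
    ... | false = trans (*-congʳ (zeroʳ _)) (zeroˡ _)
    at-a₀ : w q a₀ * e q (+ r ℤ.* (+ N ℤ.- + a₀)) ≈ e q (+ r ℤ.* (+ N ℤ.- a'))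
    at-a₀ = begin
      ind (unitᵇ q a₀) * ind (congᵇ q a₀) * e q (+ r ℤ.* (+ N ℤ.- + a₀)) ≡⟨ P.cong₂ (λ u v → ind u * ind v * e q (+ r ℤ.* (+ N ℤ.- + a₀))) unitᵇ-a₀ congᵇ-a₀ ⟩
      1# * 1# * e q (+ r ℤ.* (+ N ℤ.- + a₀))                            ≈⟨ trans (*-congʳ (*-identityˡ 1#)) (*-identityˡ _) ⟩
      e q (+ r ℤ.* (+ N ℤ.- + a₀))                                      ≈⟨ e-cong q (≋-* (≋-refl {+ r}) (≋-+ (≋-refl {+ N}) (≋-neg a₀≋a'))) ⟩
      e q (+ r ℤ.* (+ N ℤ.- a'))                                        ∎

  b-divisor : ∀ q → 0 < q → q ∣ q' → b q ≈ ι q * cR q (+ N ℤ.- a')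
  b-divisor q q>0 q∣q' = begin
    b q                                                           ≈⟨ b-factor q ⟩
    κ q * D q                                                     ≈⟨ *-cong (κ-divisor q q∣q') (S-cong′ q (λ r → *-congˡ (w-divisor q q∣q' r))) ⟩
    ι q * S q (λ r → ind (unitᵇ q r) * e q (+ r ℤ.* (+ N ℤ.- a'))) ≈⟨ *-congˡ (sym (cR-as-S q _)) ⟩
    ι q * cR q (+ N ℤ.- a')                                       ∎
    where
    instance
      q≢0 = ℕ.>-nonZero q>0

  b-one : b 1 ≈ 1#
  b-one = begin
    b 1                       ≈⟨ b-divisor 1 (ℕ.s≤s ℕ.z≤n) (Div.1∣ q') ⟩
    ι 1 * cR 1 (+ N ℤ.- a')   ≈⟨ *-cong ι-1 cR₁≈1 ⟩
    1# * 1#                   ≈⟨ *-identityˡ 1# ⟩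
    1#                        ∎
    where
    -- the only residue modulo 1 is 0
    cR₁≈1 : cR 1 (+ N ℤ.- a') ≈ 1#
    cR₁≈1 = begin
      cR 1 (+ N ℤ.- a')                     ≈⟨ cR-as-S 1 (+ N ℤ.- a') ⟩
      0# + 1# * e 1 (+ 0 ℤ.* (+ N ℤ.- a'))  ≈⟨ trans (+-identityˡ _) (*-identityˡ _) ⟩
      e 1 (+ 0 ℤ.* (+ N ℤ.- a'))            ≈⟨ e-cong 1 {+ 0 ℤ.* (+ N ℤ.- a')} {+ 0} ≋-mod1 ⟩
      e 1 (+ 0)                             ≈⟨ e-0 1 ⟩
      1#                                    ∎

  -- Case p prime, p ∤ q'.  Then lcm(p, q') = p·q' gives κ(p) = p/φ(p); every
  -- residue satisfies the (trivial) congruence condition, and removing the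
  -- non-unit a = 0 from a complete character sum leaves −e_p(r·N).
  κ-prime-coprime : ∀ p → Prime p → ¬ (p ∣ q') → κ p ≈ ι p * recip (φ p)
  κ-prime-coprime p pr p∤q' = begin
    ι (φ q') * (ι p * recip (φ (lcm p q')))              ≡⟨ P.cong (λ t → ι (φ q') * (ι p * recip (φ t))) lcm≡ ⟩
    ι (φ q') * (ι p * recip (φ (p ℕ.* q')))              ≡⟨ P.cong (λ t → ι (φ q') * (ι p * recip t)) φ-split ⟩
    ι (φ q') * (ι p * recip (φ p ℕ.* φ q'))              ≈⟨ *-congˡ (*-congˡ (recip-* (φ p) (φ q'))) ⟩
    ι (φ q') * (ι p * (recip (φ p) * recip (φ q')))      ≈⟨ solve 4 (λ f x a b → f :* (x :* (a :* b)) := (x :* a) :* (f :* b)) refl _ _ _ _ ⟩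
    (ι p * recip (φ p)) * (ι (φ q') * recip (φ q'))      ≈⟨ *-congˡ (recip-inverse (φ q')) ⟩
    (ι p * recip (φ p)) * 1#                             ≈⟨ *-identityʳ _ ⟩
    ι p * recip (φ p)                                    ∎
    where
    p>0 = ℕP.<-trans (ℕ.s≤s ℕ.z≤n) (prime>1 pr)
    instance
      φp≢0 = ℕ.>-nonZero (Totient.φ-pos p p>0)
    p⊥q' = prime-∤⇒cop pr p∤q'
    lcm≡ : lcm p q' ≡ p ℕ.* q'
    lcm≡ = P.trans (P.sym (ℕP.*-identityˡ _)) (P.trans (P.cong (ℕ._* lcm p q') (P.sym (Cop.coprime⇒gcd≡1 p⊥q'))) (gcd*lcm p q'))
    φ-split : φ (p ℕ.* q') ≡ φ p ℕ.* φ q'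
    φ-split = Totient.φ-mult p q' p>0 q'>0 p⊥q'

  D-prime-coprime : ∀ p .{{_ : NonZero p}} → Prime p → ¬ (p ∣ q') → D p ≈ - cR p (+ N)
  D-prime-coprime p pr p∤q' = begin
    D p                                                  ≈⟨ S-cong′ p (λ r → on-units p r (inner r)) ⟩
    S p (λ r → ind (unitᵇ p r) * (- e p (+ r ℤ.* + N)))  ≈⟨ S-cong′ p (λ r → sym (-‿distribʳ-* _ _)) ⟩
    S p (λ r → - (ind (unitᵇ p r) * e p (+ r ℤ.* + N)))  ≈⟨ sym (S-neg p _) ⟩
    - S p (λ r → ind (unitᵇ p r) * e p (+ r ℤ.* + N))    ≈⟨ -‿cong (sym (cR-as-S p (+ N))) ⟩
    - cR p (+ N)                                         ∎
    where
    congᵇ-true : ∀ a → congᵇ p a ≡ true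
    congᵇ-true a = true-dec _ (P.subst (_∣ ∣ + a ℤ.- a' ∣) (P.sym (Cop.coprime⇒gcd≡1 (prime-∤⇒cop pr p∤q'))) (Div.1∣ _))
    split : ∀ R N A → R ℤ.* (N ℤ.- A) ≡ R ℤ.* N ℤ.+ A ℤ.* ℤ.- R
    split = solve-∀
    inner : ∀ r → Coprime r p → S p (λ a → w p a * e p (+ r ℤ.* (+ N ℤ.- + a))) ≈ - e p (+ r ℤ.* + N)
    inner r r⊥p = begin
      S p (λ a → w p a * e p (+ r ℤ.* (+ N ℤ.- + a)))                    ≈⟨ S-cong′ p term ⟩
      S p (λ a → e p (+ r ℤ.* + N) * (ind (unitᵇ p a) * e p (+ a ℤ.* ℤ.- + r))) ≈⟨ sym (S-*ˡ p _ _) ⟩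
      e p (+ r ℤ.* + N) * S p (λ a → ind (unitᵇ p a) * e p (+ a ℤ.* ℤ.- + r)) ≈⟨ *-congˡ (unit-character-sum p pr (ℤ.- + r) p∤-r) ⟩
      e p (+ r ℤ.* + N) * - 1#                                           ≈⟨ trans (sym (-‿distribʳ-* _ _)) (-‿cong (*-identityʳ _)) ⟩
      - e p (+ r ℤ.* + N)                                                ∎
      where
      term : ∀ a → w p a * e p (+ r ℤ.* (+ N ℤ.- + a)) ≈ e p (+ r ℤ.* + N) * (ind (unitᵇ p a) * e p (+ a ℤ.* ℤ.- + r))
      term a = begin
        w p a * e p (+ r ℤ.* (+ N ℤ.- + a))                                  ≈⟨ *-cong (trans (*-congˡ (reflexive (P.cong ind (congᵇ-true a)))) (*-identityʳ _))
                                                                                       (trans (reflexive (P.cong (e p) (split (+ r) (+ N) (+ a)))) (e-+ p _ _)) ⟩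
        ind (unitᵇ p a) * (e p (+ r ℤ.* + N) * e p (+ a ℤ.* ℤ.- + r))         ≈⟨ x∙yz≈y∙xz _ _ _ ⟩
        e p (+ r ℤ.* + N) * (ind (unitᵇ p a) * e p (+ a ℤ.* ℤ.- + r))         ∎
      p∤-r : ¬ (p ∣ ∣ ℤ.- + r ∣)
      p∤-r p∣ = ℕP.<-irrefl (P.sym (r⊥p (P.subst (p ∣_) (ℤP.∣-i∣≡∣i∣ (+ r)) p∣ , Div.∣-refl))) (prime>1 pr)

  b-prime-coprime : ∀ p → Prime p → ¬ (p ∣ q') → b p ≈ (- (ι p * cR p (+ N))) /ι φ p
  b-prime-coprime p pr p∤q' = begin
    b p                                          ≈⟨ b-factor p ⟩
    κ p * D p                                    ≈⟨ *-cong (κ-prime-coprime p pr p∤q') (D-prime-coprime p pr p∤q') ⟩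
    (ι p * recip (φ p)) * (- cR p (+ N))         ≈⟨ sym (-‿distribʳ-* _ _) ⟩
    - ((ι p * recip (φ p)) * cR p (+ N))         ≈⟨ -‿cong (xy∙z≈xz∙y _ _ _) ⟩
    - ((ι p * cR p (+ N)) * recip (φ p))         ≈⟨ -‿distribˡ-* _ _ ⟩
    (- (ι p * cR p (+ N))) * recip (φ p)         ∎
    where
    instance
      p≢0 = ℕ.>-nonZero (ℕP.<-trans (ℕ.s≤s ℕ.z≤n) (prime>1 pr))

  -- Case p prime, p² ∤ q'.  Then gcd(p², q') ∣ p, so w_{p²} is p-periodic,
  -- and for a unit r mod p² (so p ∤ r) the inner sum of D(p²) vanishes by
  -- periodic orthogonality.
  D-square-vanishes : ∀ p .{{_ : NonZero p}} → Prime p → ¬ (p ℕ.* p ∣ q') → D (p ℕ.* p) ≈ 0#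
  D-square-vanishes p pr p²∤q' = S-0 (p ℕ.* p) (λ r _ → trans (on-units (p ℕ.* p) r (inner r)) (zeroʳ _))
    where
    unitᵇ-periodic-p : ∀ k i → unitᵇ (p ℕ.* p) (k ℕ.* p ℕ.+ i) ≡ unitᵇ (p ℕ.* p) i
    unitᵇ-periodic-p k i = P.trans (unitᵇ-square p (k ℕ.* p ℕ.+ i)) (P.trans (unitᵇ-periodic p k i) (P.sym (unitᵇ-square p i)))
    split : ∀ R N A → R ℤ.* (N ℤ.- A) ≡ R ℤ.* N ℤ.+ ℤ.- (R ℤ.* A)
    split = solve-∀
    inner : ∀ r → Coprime r (p ℕ.* p) → S (p ℕ.* p) (λ a → w (p ℕ.* p) a * e (p ℕ.* p) (+ r ℤ.* (+ N ℤ.- + a))) ≈ 0#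
    inner r r⊥p² = trans (S-cong′ (p ℕ.* p) term) (periodic-orthogonality p p r W p∤r W-periodic)
      where
      W : ℕ → Carrier
      W a = w (p ℕ.* p) a * e (p ℕ.* p) (+ r ℤ.* + N)
      term : ∀ a → w (p ℕ.* p) a * e (p ℕ.* p) (+ r ℤ.* (+ N ℤ.- + a)) ≈ W a * e (p ℕ.* p) (ℤ.- (+ r ℤ.* + a))
      term a = trans (*-congˡ (trans (reflexive (P.cong (e (p ℕ.* p)) (split (+ r) (+ N) (+ a))))
                                      (e-+ (p ℕ.* p) {{ℕP.m*n≢0 p p}} _ _)))
                     (sym (*-assoc _ _ _))
      p∤r : ¬ (p ∣ r)
      p∤r p∣r = ℕP.<-irrefl (P.sym (r⊥p² (p∣r , Div.m∣m*n p))) (prime>1 pr)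
      W-periodic : ∀ k i → i < p → W (k ℕ.* p ℕ.+ i) ≈ W i
      W-periodic k i _ = *-congʳ (reflexive (P.cong₂ (λ u v → ind u * ind v) (unitᵇ-periodic-p k i)
                                                (congᵇ-periodic (p ℕ.* p) p k i (gcd-square-∣ pr p²∤q'))))

  b-square-vanishes : ∀ p → Prime p → ¬ (p ℕ.* p ∣ q') → b (p ℕ.* p) ≈ 0#
  b-square-vanishes p pr p²∤q' = begin
    b (p ℕ.* p)                      ≈⟨ b-factor (p ℕ.* p) ⟩
    κ (p ℕ.* p) * D (p ℕ.* p)        ≈⟨ *-congˡ (D-square-vanishes p pr p²∤q') ⟩
    κ (p ℕ.* p) * 0#                 ≈⟨ zeroʳ _ ⟩
    0#                               ∎
    where
    instance
      p≢0 = ℕ.>-nonZero (ℕP.<-trans (ℕ.s≤s ℕ.z≤n) (prime>1 pr))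
      p²≢0 : NonZero (p ℕ.* p)
      p²≢0 = ℕP.m*n≢0 p p


-- Lemma 5.12: b(1) = 1, b is multiplicative (cubefreeness enters only
-- through positivity), and its values at primes and squares of primes are
-- as stated.
lemma5p12 : ∀ {c ℓ : Level} (F : CycloField c ℓ) → let open CF F in
    (N q' : ℕ) (a' : ℤ) → 0 < N → 0 < q' → gcd ∣ a' ∣ q' ≡ 1 →
    let open Fixed N q' a' in
    (b 1 ≈ 1#)
    × (∀ m n → Cubefree m → Cubefree n → Coprime m n → b (m *ℕ n) ≈ b m * b n)
    × (∀ p → Prime p →
         (¬ (p ∣ q') → b p ≈ (- (ι p * cR p (+ N))) /ι φ p)
         × (p ∣ q' → b p ≈ ι p * cR p (+ N -ℤ a')))
    × (∀ p → Prime p →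
         ((p ^ 2) ∣ q' → b (p ^ 2) ≈ ι (p ^ 2) * cR (p ^ 2) (+ N -ℤ a'))
         × (¬ ((p ^ 2) ∣ q') → b (p ^ 2) ≈ 0#))
lemma5p12 F N q' a' _ q'>0 a'⊥q' =
    b-one
  , (λ m n (m>0 , _) (n>0 , _) m⊥n → b-mult m n m>0 n>0 m⊥n)
  , (λ p pr → b-prime-coprime p pr , b-divisor p (p>0 pr))
  , (λ p pr → b-divisor (p ^ 2) (p²>0 pr)
            , λ p²∤q' → P.subst (λ t → Fixed.b N q' a' t ≈ 0#) (P.sym (p²≡p*p p))
                          (b-square-vanishes p pr (λ p*p∣q' → p²∤q' (P.subst (_∣ q') (P.sym (p²≡p*p p)) p*p∣q'))))
  where
  open CF F
  open Lemma5p12 F N q' a' q'>0 a'⊥q'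
  p>0 : ∀ {p} → Prime p → 0 < p
  p>0 pr = ℕP.<-trans (ℕP.n<1+n 0) (Arithmetic.prime>1 pr)
  p²≡p*p : ∀ p → p ^ 2 ≡ p *ℕ p
  p²≡p*p p = P.cong (p *ℕ_) (ℕP.*-identityʳ p)
  p²>0 : ∀ {p} → Prime p → 0 < p ^ 2
  p²>0 {p} pr = P.subst (0 <_) (P.sym (p²≡p*p p)) (ℕP.*-mono-< (p>0 pr) (p>0 pr))
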